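{- Let $k\geq 2$ be an integer and let $\ell$ be the least common multiple of all positive even integers $\leq 2k$. Then for all integers $n\geq 1$, \[\overline{pl}_{2k+1}(\ell n+2^j)\equiv \overline{p}(\ell n+2^j)\pmod 4\] for every integer $j\geq 2$ with $j\equiv 0\pmod 2$ and $2^{j-1}\leq k$. Moreover, if $k\equiv 0\pmod 2$, then for all integers $n\geq 0$, \[\overline{pl}_{2k+1}(\ell n)\equiv \overline{p}(\ell n)\pmod 4.\]
   Context: A plane overpartition of $n$ is a plane partition of $n$ (an array $(\pi_{ij})_{i,j\geq1}$ of nonnegative integers, weakly decreasing along rows and down columns, with $\sum\pi_{ij}=n$) in which entries may be overlined subject to: in each row, the last occurrence of an integer may be overlined or not and all other occurrences of that integer in the row are not overlined; in each column, the first occurrence of an integer may be overlined or not and all other occurrences of that integer in the column are overlined. A $k$-rowed plane overpartition is a plane overpartition with at most $k$ (nonzero) rows; $\overline{pl}_k(n)$ is their number ($\overline{pl}_k(0)=1$), with generating function $\sum_{n\geq0}\overline{pl}_k(n)q^n=\prod_{n\geq1}\left(\frac{1+q^n}{1-q^n}\right)^{\min\{k,n\}}$. An overpartition of $n$ is a partition of $n$ in which the first occurrence of each part may be overlined; $\overline{p}(n)$ is the number of overpartitions of $n$ ($\overline{p}(0)=1$), with generating function $\prod_{n\geq1}\frac{1+q^n}{1-q^n}$. -}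

module Defs where

open import Data.Nat using (ℕ; zero; suc; _+_; _*_; _≤ᵇ_; _≡ᵇ_)
open import Data.Nat.LCM using (lcm)
open import Data.Bool using (Bool; true; false; _∧_; _∨_; not; T)
open import Data.List using (List; []; _∷_; length; map)
open import Data.Nat.ListAction using (sum)
open import Data.Product using (Σ; _×_; _,_; proj₁)
open import Data.Fin using (Fin)
open import Function.Bundles using (_↔_)

-- An entry of a (plane) overpartition: (value , is-overlined).
Entry : Set
Entry = ℕ × Bool

-- Overpartitions
-- A partition is a weakly decreasing list of positive parts; among equal
-- parts only the FIRST occurrence may be overlined.

ovOK : List Entry → Bool
ovOK [] = true
ovOK ((a , o) ∷ []) = 1 ≤ᵇ a
ovOK ((a , o) ∷ (b , p) ∷ r) =
  (1 ≤ᵇ a) ∧ (b ≤ᵇ a) ∧ (not (a ≡ᵇ b) ∨ not p) ∧ ovOK ((b , p) ∷ r)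

Overpartition : ℕ → Set
Overpartition n = Σ (List Entry) (λ λs → T (ovOK λs ∧ (sum (map proj₁ λs) ≡ᵇ n)))

-- Plane overpartitions
-- Represented by the list of nonzero rows; each row is the list of its
-- nonzero (positive) entries from left to right (all other entries are 0).

-- Row condition: positive entries, weakly decreasing along the row, and
-- only the LAST occurrence of an integer in the row may be overlined.
rowOK : List Entry → Bool
rowOK [] = true
rowOK ((a , o) ∷ []) = 1 ≤ᵇ a
rowOK ((a , o) ∷ (b , p) ∷ r) =
  (1 ≤ᵇ a) ∧ (b ≤ᵇ a) ∧ (not o ∨ not (a ≡ᵇ b)) ∧ rowOK ((b , p) ∷ r)

-- Column condition between a row (upper) and the next row (lower):
-- the lower row is not longer (zeros below zeros), entries weakly decrease
-- down columns, and if an entry equals the one above it (so it is not the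
-- first occurrence of that integer in its column) it must be overlined.
colOK : List Entry → List Entry → Bool
colOK _ [] = true
colOK [] (_ ∷ _) = false
colOK ((a , o) ∷ r) ((b , p) ∷ s) = (b ≤ᵇ a) ∧ (not (a ≡ᵇ b) ∨ p) ∧ colOK r s

nonempty : List Entry → Bool
nonempty [] = false
nonempty (_ ∷ _) = true

rowsOK : List (List Entry) → Bool
rowsOK [] = true
rowsOK (r ∷ []) = nonempty r ∧ rowOK r
rowsOK (r ∷ s ∷ rs) = nonempty r ∧ rowOK r ∧ colOK r s ∧ rowsOK (s ∷ rs)

weight : List (List Entry) → ℕ
weight π = sum (map (λ r → sum (map proj₁ r)) π)

PlaneOverpartition : ℕ → ℕ → Set
PlaneOverpartition k n =
  Σ (List (List Entry)) (λ π → T (rowsOK π ∧ (length π ≤ᵇ k) ∧ (weight π ≡ᵇ n)))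

HasCount : Set → ℕ → Set
HasCount A m = Fin m ↔ A

lcmEven : ℕ → ℕ
lcmEven zero = 1
lcmEven (suc k) = lcm (2 * suc k) (lcmEven k)

{-# OPTIONS --safe #-}
module Submission where

-- σ toggles the overline of the last entry of the first row of a plane overpartition, τ that of
-- another entry chosen from the values alone; both entries may always be toggled, so σ pairs up all
-- plane overpartitions of N and τ pairs up those whose σ-entry is not overlined, except the hooks
-- (a row of copies of v above a column of overlined v's) where τ has nothing to toggle. Hence
-- pl̄_K(N) ≡ 2·#hooks (mod 4), and a hook with m entries v and leg h is a triple (v, m, h) with
-- v·m = N, h < m, h < K.
-- The analogous involutions on overpartitions leave only the constant ones, which are the legless
-- triples (v, m, 0), so p̄(N) ≡ 2·#legless triples (mod 4). It remains that the triples with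
-- positive leg are even in number: h ↦ min(m, K) − h pairs them up, and for K = 2k + 1 its fixed
-- points are the h ≤ k with 2h ∣ N. There are k of them when lcm(2, 4, …, 2k) ∣ N, and j of them,
-- h = 1, 2, …, 2^(j−1), when N = ℓn + 2^j.

open import Defs
open import Data.Bool using (Bool; true; false; _∧_; _∨_; not; T)
open import Data.Bool.Properties using (T-irrelevant; T-∧; T-≡; T-not-≡; ∨-comm)
open import Data.Empty using (⊥; ⊥-elim)
open import Data.Fin using (Fin; toℕ; fromℕ<)
import Data.Fin as Fin
open import Data.Fin.Permutation using (↔⇒≡)
open import Data.Fin.Properties using (+↔⊎; *↔×; 2↔Bool; 0↔⊥; 1↔⊤; toℕ-injective; toℕ<n; toℕ-fromℕ<)
open import Data.List using (List; []; _∷_; length; map; replicate)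
open import Data.List.Properties using (length-replicate; length-map)
open import Data.List.Relation.Unary.All using (All; []; _∷_)
open import Data.Maybe using (Maybe; just; nothing; _<∣>_; is-nothing)
import Data.Maybe as Maybe
open import Data.Maybe.Properties using (just-injective)
open import Data.Nat
  using (ℕ; zero; suc; _+_; _*_; _∸_; _^_; _⊓_; _%_; _≤_; _<_; _≤ᵇ_; _<ᵇ_; _≡ᵇ_; _≟_; _≤?_; s≤s; z≤n; >-nonZero)
open import Data.Nat.Coprimality using (Coprime; coprime-divisor)
open import Data.Nat.Divisibility
  using (_∣_; divides; _∣?_; ∣-trans; 1∣_; ∣1⇒≡1; 0∣⇒≡0; ∣⇒≤; ∣m⇒∣m*n; ∣m+n∣m⇒∣n; ∣m∣n⇒∣m+n; *-monoʳ-∣; *-cancelˡ-∣;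
         m%n≡0⇒n∣m)
open import Data.Nat.DivMod using ([m+kn]%n≡m%n)
open import Data.Nat.GCD using (gcd)
open import Data.Nat.LCM using (lcm; m∣lcm[m,n]; n∣lcm[m,n]; gcd*lcm)
open import Data.Nat.ListAction using (sum)
open import Data.Nat.Properties
  using (≡ᵇ⇒≡; ≡⇒≡ᵇ; ≤ᵇ⇒≤; ≤⇒≤ᵇ; <ᵇ⇒<; <⇒<ᵇ; suc-injective; ≤-refl; ≤-trans; ≤-antisym; ≤-pred; <⇒≤; <⇒≢; <-asym;
         <-cmp; <-≤-trans; ≤-<-trans; ≤∧≢⇒<; ≮⇒≥; ≰⇒>; <⇒≤pred; n≮0; n<1+n; n≢0⇒n>0; m≤m+n; m≤n+m; m<m+n; m<n+m;
         m≤n⇒m≤1+n; +-comm; +-suc; +-identityʳ; +-cancelˡ-≡; +-monoʳ-<; +-monoˡ-<; *-comm; *-assoc; *-zeroʳ;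
         *-distribˡ-+; *-distribʳ-+; *-mono-≤; *-monoʳ-≤; *-cancelˡ-≤; *-cancelʳ-≡; m*n≡0⇒m≡0∨n≡0; m∸n+n≡m;
         m+n∸n≡m; m∸[m∸n]≡n; m<n⇒0<n∸m; m<ᵇn⇒1+m+[n-1+m]≡n; m⊓n≤m; m⊓n≤n; ⊓-pres-m<; m≤n⇒m⊓n≡m; m≥n⇒m⊓n≡n;
         even≢odd; m^n>0; ^-monoʳ-≤; ^-monoʳ-<)
open import Data.Nat.Tactic.RingSolver using (solve-∀)
open import Data.Product using (Σ; _×_; _,_; proj₁; proj₂; map₁)
open import Data.Product.Function.NonDependent.Propositional using (_×-↔_)
open import Data.Sum using (_⊎_; inj₁; inj₂; [_,_]′)
open import Data.Sum.Function.Propositional using (_⊎-↔_)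
open import Data.Unit using (⊤)
open import Function using (_∘_)
open import Function.Bundles using (_↔_; mk↔ₛ′; Inverse; Equivalence)
open import Function.Properties.Inverse using (↔-trans; ↔-sym)
open import Relation.Binary.Definitions using (tri<; tri≈; tri>)
open import Relation.Binary.PropositionalEquality
open import Relation.Nullary using (yes; no; ¬_)

T-∧-intro : {a b : Bool} → T a → T b → T (a ∧ b)
T-∧-intro p q = Equivalence.from T-∧ (p , q)

T-∧-split : {a b : Bool} → T (a ∧ b) → T a × T b
T-∧-split = Equivalence.to T-∧

T-∧-l : {a b : Bool} → T (a ∧ b) → T a
T-∧-l = proj₁ ∘ T-∧-split

T-∧-r : {a b : Bool} → T (a ∧ b) → T b
T-∧-r = proj₂ ∘ T-∧-split

T-or-T-not : (b : Bool) → T b ⊎ T (not b)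
T-or-T-not true = inj₁ _
T-or-T-not false = inj₂ _

T-or-T-not-T : {b : Bool} (t : T b) → T-or-T-not b ≡ inj₁ t
T-or-T-not-T {true} _ = refl

T-or-T-not-T-not : {b : Bool} (t : T (not b)) → T-or-T-not b ≡ inj₂ t
T-or-T-not-T-not {false} _ = refl

T-not-not : {b : Bool} → T b → T (not (not b))
T-not-not {true} t = t

≡ᵇ-false : ∀ {a b} → a ≢ b → (a ≡ᵇ b) ≡ false
≡ᵇ-false {a} {b} a≢b with a ≡ᵇ b in eq
... | false = refl
... | true = ⊥-elim (a≢b (≡ᵇ⇒≡ a b (subst T (sym eq) _)))

≡ᵇ-refl : ∀ a → (a ≡ᵇ a) ≡ true
≡ᵇ-refl a = Equivalence.to T-≡ (≡⇒≡ᵇ a a refl)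

≤ᵇ-refl : ∀ a → (a ≤ᵇ a) ≡ true
≤ᵇ-refl a = Equivalence.to T-≡ (≤⇒≤ᵇ (≤-refl {a}))

T-not-≡ᵇ⇒≢ : ∀ {a b} → T (not (a ≡ᵇ b)) → a ≢ b
T-not-≡ᵇ⇒≢ {a} {b} t a≡b = subst T (Equivalence.to T-not-≡ t) (≡⇒≡ᵇ a b a≡b)

≢⇒T-not-≡ᵇ : ∀ {a b} → a ≢ b → T (not (a ≡ᵇ b))
≢⇒T-not-≡ᵇ a≢b = subst (T ∘ not) (sym (≡ᵇ-false a≢b)) _

<ᵇ-false : ∀ m n → ¬ m < n → (m <ᵇ n) ≡ false
<ᵇ-false m n m≮n with m <ᵇ n in eq
... | false = refl
... | true = ⊥-elim (m≮n (<ᵇ⇒< m n (subst T (sym eq) _)))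

<ᵇ-true : ∀ m n → m < n → (m <ᵇ n) ≡ true
<ᵇ-true m n m<n = Equivalence.to T-≡ (<⇒<ᵇ m<n)

just-≢⇒≢ : ∀ {a b : ℕ} → just a ≢ just b → a ≢ b
just-≢⇒≢ h = h ∘ cong just

Subset : {X : Set} → (X → Bool) → Set
Subset {X} P = Σ X (λ x → T (P x))

subset-≡ : {X : Set} {P : X → Bool} {x y : Subset P} → proj₁ x ≡ proj₁ y → x ≡ y
subset-≡ {x = x , p} {.x , q} refl = cong (x ,_) (T-irrelevant p q)

count-unique : {A : Set} {m n : ℕ} → HasCount A m → HasCount A n → m ≡ n
count-unique e f = ↔⇒≡ (↔-trans e (↔-sym f))

count-⊎ : {A B : Set} {m n : ℕ} → HasCount A m → HasCount B n → HasCount (A ⊎ B) (m + n)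
count-⊎ e f = ↔-trans +↔⊎ (e ⊎-↔ f)

count-Bool× : {A : Set} {m : ℕ} → HasCount A m → HasCount (Bool × A) (2 * m)
count-Bool× e = ↔-trans *↔× (2↔Bool ×-↔ e)

count-T : (b : Bool) → Σ ℕ (HasCount (T b))
count-T true = 1 , 1↔⊤
count-T false = 0 , 0↔⊥

Σ-Fin-suc-↔ : {n : ℕ} (Q : Fin (suc n) → Set) →
  Σ (Fin (suc n)) Q ↔ (Q Fin.zero ⊎ Σ (Fin n) (Q ∘ Fin.suc))
Σ-Fin-suc-↔ Q = mk↔ₛ′ to from to∘from from∘to
  where
  to : Σ (Fin _) Q → Q Fin.zero ⊎ Σ (Fin _) (Q ∘ Fin.suc)
  to (Fin.zero , p) = inj₁ p
  to (Fin.suc i , p) = inj₂ (i , p)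
  from : Q Fin.zero ⊎ Σ (Fin _) (Q ∘ Fin.suc) → Σ (Fin _) Q
  from (inj₁ p) = Fin.zero , p
  from (inj₂ (i , p)) = Fin.suc i , p
  to∘from : ∀ y → to (from y) ≡ y
  to∘from (inj₁ p) = refl
  to∘from (inj₂ _) = refl
  from∘to : ∀ x → from (to x) ≡ x
  from∘to (Fin.zero , p) = refl
  from∘to (Fin.suc i , p) = refl

count-Fin-subset : (n : ℕ) (q : Fin n → Bool) → Σ ℕ (HasCount (Subset q))
count-Fin-subset zero q = 0 , mk↔ₛ′ (λ ()) (λ { (() , _) }) (λ { (() , _) }) (λ ())
count-Fin-subset (suc n) q =
  let c₀ , e₀ = count-T (q Fin.zero)
      c , e = count-Fin-subset n (q ∘ Fin.suc)
  in c₀ + c , ↔-trans (count-⊎ e₀ e) (↔-sym (Σ-Fin-suc-↔ (T ∘ q)))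

count-one : {A : Set} (x : A) → (∀ y → x ≡ y) → HasCount A 1
count-one x x-unique = mk↔ₛ′ (λ _ → x) (λ _ → Fin.zero) x-unique (λ { Fin.zero → refl ; (Fin.suc ()) })

module _ {X : Set} where

  count-subset : (P q : X → Bool) {n : ℕ} → HasCount (Subset P) n →
    Σ ℕ (HasCount (Subset (λ x → P x ∧ q x)))
  count-subset P q {n} e =
    let c , e′ = count-Fin-subset n (q ∘ proj₁ ∘ to)
    in c , ↔-trans e′ (mk↔ₛ′ restrict extend restrict∘extend extend∘restrict)
    where
    open Inverse e
    restrict : Subset (q ∘ proj₁ ∘ to) → Subset (λ x → P x ∧ q x)
    restrict (i , qi) = proj₁ (to i) , T-∧-intro (proj₂ (to i)) qi
    extend : Subset (λ x → P x ∧ q x) → Subset (q ∘ proj₁ ∘ to)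
    extend (x , pq) = from (x , T-∧-l pq) , subst (T ∘ q ∘ proj₁) (sym (strictlyInverseˡ _)) (T-∧-r pq)
    restrict∘extend : ∀ y → restrict (extend y) ≡ y
    restrict∘extend (x , pq) = subset-≡ (cong proj₁ (strictlyInverseˡ _))
    extend∘restrict : ∀ y → extend (restrict y) ≡ y
    extend∘restrict (i , qi) = subset-≡ (trans (cong from (subset-≡ refl)) (strictlyInverseʳ i))

  split-↔ : (P q : X → Bool) →
    Subset P ↔ (Subset (λ x → P x ∧ q x) ⊎ Subset (λ x → P x ∧ not (q x)))
  split-↔ P q = mk↔ₛ′ to from to∘from from∘to
    where
    to′ : ∀ x → T (P x) → T (q x) ⊎ T (not (q x)) →
      Subset (λ x → P x ∧ q x) ⊎ Subset (λ x → P x ∧ not (q x))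
    to′ x p (inj₁ t) = inj₁ (x , T-∧-intro p t)
    to′ x p (inj₂ t) = inj₂ (x , T-∧-intro p t)
    to : Subset P → Subset (λ x → P x ∧ q x) ⊎ Subset (λ x → P x ∧ not (q x))
    to (x , p) = to′ x p (T-or-T-not (q x))
    from : Subset (λ x → P x ∧ q x) ⊎ Subset (λ x → P x ∧ not (q x)) → Subset P
    from (inj₁ (x , p)) = x , T-∧-l p
    from (inj₂ (x , p)) = x , T-∧-l p
    to∘from : ∀ y → to (from y) ≡ y
    to∘from (inj₁ (x , p)) =
      trans (cong (to′ x (T-∧-l p)) (T-or-T-not-T (T-∧-r p))) (cong inj₁ (subset-≡ refl))
    to∘from (inj₂ (x , p)) =
      trans (cong (to′ x (T-∧-l p)) (T-or-T-not-T-not (T-∧-r p))) (cong inj₂ (subset-≡ refl))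
    from∘to′ : ∀ x p d → from (to′ x p d) ≡ (x , p)
    from∘to′ x p (inj₁ _) = subset-≡ refl
    from∘to′ x p (inj₂ _) = subset-≡ refl
    from∘to : ∀ y → from (to y) ≡ y
    from∘to (x , p) = from∘to′ x p (T-or-T-not (q x))

  record SideSwappingInvolution (P side : X → Bool) : Set where
    field
      ι : X → X
      ι-preserves : ∀ x → T (P x) → T (P (ι x))
      ι-involutive : ∀ x → T (P x) → ι (ι x) ≡ x
      ι-swaps : ∀ x → T (P x) → side (ι x) ≡ not (side x)

  involution-↔ : {P side : X → Bool} → SideSwappingInvolution P side →
    Subset P ↔ (Bool × Subset (λ x → P x ∧ side x))
  involution-↔ {P} {side} inv = mk↔ₛ′ to from to∘from from∘to
    where
    open SideSwappingInvolution inv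
    T-side-ι : ∀ {x} → T (P x) → T (not (side x)) → T (side (ι x))
    T-side-ι {x} p t = subst T (sym (ι-swaps x p)) t
    to′ : ∀ x → T (P x) → T (side x) ⊎ T (not (side x)) → Bool × Subset (λ x → P x ∧ side x)
    to′ x p (inj₁ t) = false , x , T-∧-intro p t
    to′ x p (inj₂ t) = true , ι x , T-∧-intro (ι-preserves x p) (T-side-ι p t)
    to : Subset P → Bool × Subset (λ x → P x ∧ side x)
    to (x , p) = to′ x p (T-or-T-not (side x))
    from : Bool × Subset (λ x → P x ∧ side x) → Subset P
    from (false , x , p) = x , T-∧-l p
    from (true , x , p) = ι x , ι-preserves x (T-∧-l p)
    from∘to′ : ∀ x p d → from (to′ x p d) ≡ (x , p)
    from∘to′ x p (inj₁ _) = subset-≡ refl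
    from∘to′ x p (inj₂ _) = subset-≡ (ι-involutive x p)
    from∘to : ∀ y → from (to y) ≡ y
    from∘to (x , p) = from∘to′ x p (T-or-T-not (side x))
    to∘from : ∀ y → to (from y) ≡ y
    to∘from (false , x , p) =
      trans (cong (to′ x (T-∧-l p)) (T-or-T-not-T (T-∧-r p))) (cong (false ,_) (subset-≡ refl))
    to∘from (true , x , p) =
      trans (cong (to′ (ι x) _)
                  (T-or-T-not-T-not (subst (T ∘ not) (sym (ι-swaps x (T-∧-l p))) (T-not-not (T-∧-r p)))))
            (cong (true ,_) (subset-≡ (ι-involutive x (T-∧-l p))))

  count-split : (P q : X → Bool) {n : ℕ} → HasCount (Subset P) n →
    Σ ℕ λ c → Σ ℕ λ d →
      HasCount (Subset (λ x → P x ∧ q x)) c × HasCount (Subset (λ x → P x ∧ not (q x))) d × n ≡ c + d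
  count-split P q e =
    let c , eq = count-subset P q e
        d , enq = count-subset P (not ∘ q) e
    in c , d , eq , enq , count-unique e (↔-trans (count-⊎ eq enq) (↔-sym (split-↔ P q)))

  count-involution : {P side : X → Bool} → SideSwappingInvolution P side → {n : ℕ} → HasCount (Subset P) n →
    Σ ℕ λ c → HasCount (Subset (λ x → P x ∧ side x)) c × n ≡ 2 * c
  count-involution {P} {side} inv e =
    let c , es = count-subset P side e
    in c , es , count-unique e (↔-trans (count-Bool× es) (↔-sym (involution-↔ inv)))

twice-sum : ∀ {a b c x} → a ≡ 2 * b → b ≡ c + 2 * x → a ≡ 2 * c + 4 * x
twice-sum {c = c} {x} refl refl = trans (*-distribˡ-+ 2 c (2 * x)) (cong (2 * c +_) (sym (*-assoc 2 2 x)))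

Row : Set
Row = List Entry

values : Row → List ℕ
values = map proj₁

valueAt : List ℕ → ℕ → Maybe ℕ
valueAt [] _ = nothing
valueAt (a ∷ l) zero = just a
valueAt (a ∷ l) (suc j) = valueAt l j

toggleAt : ℕ → Row → Row
toggleAt _ [] = []
toggleAt zero ((a , o) ∷ r) = (a , not o) ∷ r
toggleAt (suc j) (e ∷ r) = e ∷ toggleAt j r

overlinedAt : ℕ → Row → Bool
overlinedAt _ [] = false
overlinedAt zero ((a , o) ∷ r) = o
overlinedAt (suc j) (_ ∷ r) = overlinedAt j r

values-toggleAt : ∀ j r → values (toggleAt j r) ≡ values r
values-toggleAt _ [] = refl
values-toggleAt zero ((a , o) ∷ r) = refl
values-toggleAt (suc j) (e ∷ r) = cong (proj₁ e ∷_) (values-toggleAt j r)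

toggleAt-involutive : ∀ j r → toggleAt j (toggleAt j r) ≡ r
toggleAt-involutive _ [] = refl
toggleAt-involutive zero ((a , false) ∷ r) = refl
toggleAt-involutive zero ((a , true) ∷ r) = refl
toggleAt-involutive (suc j) (e ∷ r) = cong (e ∷_) (toggleAt-involutive j r)

overlinedAt-toggleAt : ∀ j r → valueAt (values r) j ≢ nothing →
  overlinedAt j (toggleAt j r) ≡ not (overlinedAt j r)
overlinedAt-toggleAt j [] j∉r = ⊥-elim (j∉r refl)
overlinedAt-toggleAt zero ((a , o) ∷ r) _ = refl
overlinedAt-toggleAt (suc j) (e ∷ r) j∈r = overlinedAt-toggleAt j r j∈r

overlinedAt-toggleAt-≢ : ∀ i j r → i ≢ j → overlinedAt i (toggleAt j r) ≡ overlinedAt i r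
overlinedAt-toggleAt-≢ i j [] _ = refl
overlinedAt-toggleAt-≢ zero zero (e ∷ r) i≢j = ⊥-elim (i≢j refl)
overlinedAt-toggleAt-≢ zero (suc j) (e ∷ r) _ = refl
overlinedAt-toggleAt-≢ (suc i) zero ((a , o) ∷ r) _ = refl
overlinedAt-toggleAt-≢ (suc i) (suc j) (e ∷ r) i≢j = overlinedAt-toggleAt-≢ i j r (i≢j ∘ cong suc)

rowOK-toggleAt : ∀ j r → valueAt (values r) j ≢ valueAt (values r) (suc j) → rowOK (toggleAt j r) ≡ rowOK r
rowOK-toggleAt _ [] _ = refl
rowOK-toggleAt zero ((a , o) ∷ []) _ = refl
rowOK-toggleAt zero ((a , o) ∷ (b , p) ∷ s) a≢b rewrite ≡ᵇ-false (just-≢⇒≢ a≢b) with o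
... | true = refl
... | false = refl
rowOK-toggleAt (suc j) ((a , o) ∷ []) _ = refl
rowOK-toggleAt (suc zero) ((a , o) ∷ (b , p) ∷ s) h =
  cong (λ z → (1 ≤ᵇ a) ∧ (b ≤ᵇ a) ∧ (not o ∨ not (a ≡ᵇ b)) ∧ z) (rowOK-toggleAt zero ((b , p) ∷ s) h)
rowOK-toggleAt (suc (suc j)) ((a , o) ∷ (b , p) ∷ s) h =
  cong (λ z → (1 ≤ᵇ a) ∧ (b ≤ᵇ a) ∧ (not o ∨ not (a ≡ᵇ b)) ∧ z) (rowOK-toggleAt (suc j) ((b , p) ∷ s) h)

colOK-toggleAt-upper : ∀ j r s → colOK (toggleAt j r) s ≡ colOK r s
colOK-toggleAt-upper j r [] = refl
colOK-toggleAt-upper j [] (_ ∷ s) = refl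
colOK-toggleAt-upper zero ((a , o) ∷ r) ((b , p) ∷ s) = refl
colOK-toggleAt-upper (suc j) ((a , o) ∷ r) ((b , p) ∷ s) =
  cong (λ z → (b ≤ᵇ a) ∧ (not (a ≡ᵇ b) ∨ p) ∧ z) (colOK-toggleAt-upper j r s)

colOK-toggleAt-lower : ∀ j r s → valueAt (values r) j ≢ valueAt (values s) j →
  colOK r (toggleAt j s) ≡ colOK r s
colOK-toggleAt-lower j r [] _ = refl
colOK-toggleAt-lower zero [] (_ ∷ s) _ = refl
colOK-toggleAt-lower (suc j) [] (_ ∷ s) _ = refl
colOK-toggleAt-lower zero ((a , o) ∷ r) ((b , p) ∷ s) a≢b rewrite ≡ᵇ-false (just-≢⇒≢ a≢b) = refl
colOK-toggleAt-lower (suc j) ((a , o) ∷ r) ((b , p) ∷ s) h =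
  cong (λ z → (b ≤ᵇ a) ∧ (not (a ≡ᵇ b) ∨ p) ∧ z) (colOK-toggleAt-lower j r s h)

nonempty-toggleAt : ∀ j r → nonempty (toggleAt j r) ≡ nonempty r
nonempty-toggleAt j [] = refl
nonempty-toggleAt zero (e ∷ r) = refl
nonempty-toggleAt (suc j) (e ∷ r) = refl

rowsOK-toggleAt-head : ∀ j r rs → valueAt (values r) j ≢ valueAt (values r) (suc j) →
  rowsOK (toggleAt j r ∷ rs) ≡ rowsOK (r ∷ rs)
rowsOK-toggleAt-head j r [] h rewrite nonempty-toggleAt j r | rowOK-toggleAt j r h = refl
rowsOK-toggleAt-head j r (s ∷ rs) h
  rewrite nonempty-toggleAt j r | rowOK-toggleAt j r h | colOK-toggleAt-upper j r s = refl

rowOK-∷∷ : ∀ a o b p r → T (rowOK ((a , o) ∷ (b , p) ∷ r)) →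
  T (1 ≤ᵇ a) × T (b ≤ᵇ a) × T (not o ∨ not (a ≡ᵇ b)) × T (rowOK ((b , p) ∷ r))
rowOK-∷∷ a o b p r h =
  let h₁ , h₂₃₄ = T-∧-split h ; h₂ , h₃₄ = T-∧-split h₂₃₄ in h₁ , h₂ , T-∧-split h₃₄

colOK-∷∷ : ∀ a o r b p s → T (colOK ((a , o) ∷ r) ((b , p) ∷ s)) →
  T (b ≤ᵇ a) × T (not (a ≡ᵇ b) ∨ p) × T (colOK r s)
colOK-∷∷ a o r b p s h = let h₁ , h₂₃ = T-∧-split h in h₁ , T-∧-split h₂₃

rowsOK-∷∷ : ∀ r s π → T (rowsOK (r ∷ s ∷ π)) →
  T (nonempty r) × T (rowOK r) × T (colOK r s) × T (rowsOK (s ∷ π))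
rowsOK-∷∷ r s π h =
  let h₁ , h₂₃₄ = T-∧-split h ; h₂ , h₃₄ = T-∧-split h₂₃₄ in h₁ , h₂ , T-∧-split h₃₄

rowsOK-head : ∀ r π → T (rowsOK (r ∷ π)) → T (nonempty r) × T (rowOK r)
rowsOK-head r [] h = T-∧-split h
rowsOK-head r (s ∷ π) h = let h₁ , h₂ , _ = rowsOK-∷∷ r s π h in h₁ , h₂

Plane : Set
Plane = List Row

Position : Set
Position = ℕ × ℕ

planeValues : Plane → List (List ℕ)
planeValues = map values

valueAtᴾ : List (List ℕ) → Position → Maybe ℕ
valueAtᴾ [] _ = nothing
valueAtᴾ (l ∷ V) (zero , j) = valueAt l j
valueAtᴾ (l ∷ V) (suc i , j) = valueAtᴾ V (i , j)

toggle : Position → Plane → Plane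
toggle _ [] = []
toggle (zero , j) (r ∷ π) = toggleAt j r ∷ π
toggle (suc i , j) (r ∷ π) = r ∷ toggle (i , j) π

overlined : Position → Plane → Bool
overlined _ [] = false
overlined (zero , j) (r ∷ π) = overlinedAt j r
overlined (suc i , j) (r ∷ π) = overlined (i , j) π

planeValues-toggle : ∀ p π → planeValues (toggle p π) ≡ planeValues π
planeValues-toggle _ [] = refl
planeValues-toggle (zero , j) (r ∷ π) = cong (_∷ planeValues π) (values-toggleAt j r)
planeValues-toggle (suc i , j) (r ∷ π) = cong (values r ∷_) (planeValues-toggle (i , j) π)

toggle-involutive : ∀ p π → toggle p (toggle p π) ≡ π
toggle-involutive _ [] = refl
toggle-involutive (zero , j) (r ∷ π) = cong (_∷ π) (toggleAt-involutive j r)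
toggle-involutive (suc i , j) (r ∷ π) = cong (r ∷_) (toggle-involutive (i , j) π)

overlined-toggle : ∀ p π → valueAtᴾ (planeValues π) p ≢ nothing →
  overlined p (toggle p π) ≡ not (overlined p π)
overlined-toggle _ [] p∉π = ⊥-elim (p∉π refl)
overlined-toggle (zero , j) (r ∷ π) j∈r = overlinedAt-toggleAt j r j∈r
overlined-toggle (suc i , j) (r ∷ π) p∈π = overlined-toggle (i , j) π p∈π

overlined-toggle-≢ : ∀ p q π → p ≢ q → overlined p (toggle q π) ≡ overlined p π
overlined-toggle-≢ _ _ [] _ = refl
overlined-toggle-≢ (zero , j) (zero , j′) (r ∷ π) p≢q = overlinedAt-toggleAt-≢ j j′ r (p≢q ∘ cong (0 ,_))
overlined-toggle-≢ (zero , j) (suc i′ , j′) (r ∷ π) _ = refl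
overlined-toggle-≢ (suc i , j) (zero , j′) (r ∷ π) _ = refl
overlined-toggle-≢ (suc i , j) (suc i′ , j′) (r ∷ π) p≢q =
  overlined-toggle-≢ (i , j) (i′ , j′) π (p≢q ∘ cong (map₁ suc))

toggleMaybe : Maybe Position → Plane → Plane
toggleMaybe nothing π = π
toggleMaybe (just p) π = toggle p π

overlinedMaybe : Maybe Position → Plane → Bool
overlinedMaybe nothing π = false
overlinedMaybe (just p) π = overlined p π

Distinct : Maybe Position → Maybe Position → Set
Distinct (just p) (just q) = p ≢ q
Distinct _ _ = ⊤

overlinedMaybe-toggleMaybe : ∀ x y π → Distinct x y → overlinedMaybe x (toggleMaybe y π) ≡ overlinedMaybe x π
overlinedMaybe-toggleMaybe nothing y π _ = refl
overlinedMaybe-toggleMaybe (just p) nothing π _ = refl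
overlinedMaybe-toggleMaybe (just p) (just q) π p≢q = overlined-toggle-≢ p q π p≢q

-- The position is read off the values, which toggling leaves unchanged; hence toggleBy is an involution.
module _ (position : List (List ℕ) → Maybe Position) where

  toggleBy : Plane → Plane
  toggleBy π = toggleMaybe (position (planeValues π)) π

  overlinedBy : Plane → Bool
  overlinedBy π = overlinedMaybe (position (planeValues π)) π

  planeValues-toggleBy : ∀ π → planeValues (toggleBy π) ≡ planeValues π
  planeValues-toggleBy π with position (planeValues π)
  ... | nothing = refl
  ... | just p = planeValues-toggle p π

  toggleBy-involutive : ∀ π → toggleBy (toggleBy π) ≡ π
  toggleBy-involutive π rewrite planeValues-toggleBy π with position (planeValues π)
  ... | nothing = refl
  ... | just p = toggle-involutive p π

  overlinedBy-toggleBy : ∀ π {p} → position (planeValues π) ≡ just p → valueAtᴾ (planeValues π) p ≢ nothing →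
    overlinedBy (toggleBy π) ≡ not (overlinedBy π)
  overlinedBy-toggleBy π {p} eq p∈π rewrite planeValues-toggleBy π | eq = overlined-toggle p π p∈π

overlinedBy-toggleBy-distinct : ∀ pos pos′ π → Distinct (pos (planeValues π)) (pos′ (planeValues π)) →
  overlinedBy pos (toggleBy pos′ π) ≡ overlinedBy pos π
overlinedBy-toggleBy-distinct pos pos′ π d rewrite planeValues-toggleBy pos′ π =
  overlinedMaybe-toggleMaybe (pos (planeValues π)) (pos′ (planeValues π)) π d

-- The involutions σ and τ

firstChange : ℕ → List ℕ → Maybe ℕ
firstChange a [] = nothing
firstChange a (b ∷ l) with a ≟ b
... | yes _ = Maybe.map suc (firstChange b l)
... | no _ = just 0

lastOf : ℕ → List ℕ → ℕ
lastOf a [] = a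
lastOf a (b ∷ l) = lastOf b l

-- τ toggles the last a of a non-constant first row a ∷ l. Below a constant first row it walks down
-- the column of one-entry rows a (whose overlines are forced) and toggles the first entry whose
-- overline is free: a one-entry row w ≠ a, or the last entry of a longer row if it is not a.
τ-positionBelow : ℕ → List (List ℕ) → Maybe Position
τ-positionBelow v [] = nothing
τ-positionBelow v ([] ∷ V) = nothing
τ-positionBelow v ((w ∷ []) ∷ V) with w ≟ v
... | yes _ = Maybe.map (map₁ suc) (τ-positionBelow v V)
... | no _ = just (0 , 0)
τ-positionBelow v ((w ∷ x ∷ l) ∷ V) with lastOf x l ≟ v
... | yes _ = nothing
... | no _ = just (0 , suc (length l))

τ-position : List (List ℕ) → Maybe Position
τ-position ((a ∷ l) ∷ V) = Maybe.map (0 ,_) (firstChange a l) <∣> Maybe.map (map₁ suc) (τ-positionBelow a V)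
τ-position _ = nothing

σ-position : List (List ℕ) → Maybe Position
σ-position ((a ∷ l) ∷ _) = just (0 , length l)
σ-position _ = nothing

valueAt-length : ∀ l → valueAt l (length l) ≡ nothing
valueAt-length [] = refl
valueAt-length (a ∷ l) = valueAt-length l

valueAt-lastOf : ∀ a l → valueAt (a ∷ l) (length l) ≡ just (lastOf a l)
valueAt-lastOf a [] = refl
valueAt-lastOf a (b ∷ l) = valueAt-lastOf b l

valueAt-inRange-pred : ∀ l j → valueAt l (suc j) ≢ nothing → valueAt l j ≢ nothing
valueAt-inRange-pred [] j h = λ _ → h refl
valueAt-inRange-pred (a ∷ l) zero _ = λ ()
valueAt-inRange-pred (a ∷ l) (suc j) h = valueAt-inRange-pred l j h

valueAt-All : ∀ {v} l j {w} → All (_≡ v) l → valueAt l j ≡ just w → w ≡ v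
valueAt-All (a ∷ l) zero (a≡v ∷ _) refl = a≡v
valueAt-All (a ∷ l) (suc j) (_ ∷ l≡v) eq = valueAt-All l j l≡v eq

firstChange-changes : ∀ a l {j} → firstChange a l ≡ just j → valueAt (a ∷ l) j ≢ valueAt (a ∷ l) (suc j)
firstChange-changes a (b ∷ l) eq with a ≟ b
firstChange-changes a (b ∷ l) refl | no a≢b = a≢b ∘ just-injective
... | yes _ with firstChange b l in eq′
firstChange-changes a (b ∷ l) refl | yes _ | just j = firstChange-changes b l eq′

firstChange-inRange : ∀ a l {j} → firstChange a l ≡ just j → valueAt (a ∷ l) (suc j) ≢ nothing
firstChange-inRange a (b ∷ l) eq with a ≟ b
firstChange-inRange a (b ∷ l) refl | no _ = λ ()
... | yes _ with firstChange b l in eq′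
firstChange-inRange a (b ∷ l) refl | yes _ | just j = firstChange-inRange b l eq′

firstChange-constant : ∀ a l → firstChange a l ≡ nothing → All (_≡ a) (a ∷ l)
firstChange-constant a [] _ = refl ∷ []
firstChange-constant a (b ∷ l) eq with a ≟ b
... | yes refl with firstChange b l in eq′
... | nothing = refl ∷ firstChange-constant b l eq′

lastOf-inRange : ∀ a l → valueAt (a ∷ l) (length l) ≢ nothing
lastOf-inRange a l e with trans (sym (valueAt-lastOf a l)) e
... | ()

τ-positionBelow-inRange : ∀ v V {p} → τ-positionBelow v V ≡ just p → valueAtᴾ V p ≢ nothing
τ-positionBelow-inRange v ((w ∷ []) ∷ V) eq with w ≟ v
τ-positionBelow-inRange v ((w ∷ []) ∷ V) refl | no _ = λ ()
... | yes _ with τ-positionBelow v V in eq′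
τ-positionBelow-inRange v ((w ∷ []) ∷ V) refl | yes _ | just (i , j) = τ-positionBelow-inRange v V eq′
τ-positionBelow-inRange v ((w ∷ x ∷ l) ∷ V) eq with lastOf x l ≟ v
τ-positionBelow-inRange v ((w ∷ x ∷ l) ∷ V) refl | no _ = lastOf-inRange x l

τ-position-inRange : ∀ V {p} → τ-position V ≡ just p → valueAtᴾ V p ≢ nothing
τ-position-inRange ((a ∷ l) ∷ V) eq with firstChange a l in eq′
τ-position-inRange ((a ∷ l) ∷ V) refl | just j = valueAt-inRange-pred (a ∷ l) j (firstChange-inRange a l eq′)
... | nothing with τ-positionBelow a V in eq″
τ-position-inRange ((a ∷ l) ∷ V) refl | nothing | just (i , j) = τ-positionBelow-inRange a V eq″

σ-position-inRange : ∀ V {p} → σ-position V ≡ just p → valueAtᴾ V p ≢ nothing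
σ-position-inRange ((a ∷ l) ∷ V) refl = lastOf-inRange a l

σ-τ-distinct : ∀ V → Distinct (σ-position V) (τ-position V)
σ-τ-distinct [] = _
σ-τ-distinct ([] ∷ V) = _
σ-τ-distinct ((a ∷ l) ∷ V) with firstChange a l in eq
... | just j = λ e →
  firstChange-inRange a l eq (subst (λ k → valueAt (a ∷ l) (suc k) ≡ nothing) (cong proj₂ e) (valueAt-length l))
... | nothing with τ-positionBelow a V
... | nothing = _
... | just (i , j) = λ ()

¬is-nothing⇒just : {x : Maybe Position} → T (not (is-nothing x)) → Σ Position λ p → x ≡ just p
¬is-nothing⇒just {just p} _ = p , refl

σ τ : Plane → Plane
σ = toggleBy σ-position
τ = toggleBy τ-position

σ-overlined τ-overlined isHook : Plane → Bool
σ-overlined = overlinedBy σ-position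
τ-overlined = overlinedBy τ-position
isHook π = is-nothing (τ-position (planeValues π))

toggleMaybe-below : ∀ x r π → toggleMaybe (Maybe.map (map₁ suc) x) (r ∷ π) ≡ r ∷ toggleMaybe x π
toggleMaybe-below nothing r π = refl
toggleMaybe-below (just p) r π = refl

rowsOK-σ : ∀ π → rowsOK (σ π) ≡ rowsOK π
rowsOK-σ [] = refl
rowsOK-σ ([] ∷ π) = refl
rowsOK-σ (((a , o) ∷ r) ∷ π) = rowsOK-toggleAt-head (length (values r)) ((a , o) ∷ r) π
  (λ e → lastOf-inRange a (values r) (trans e (valueAt-length (values r))))

rowsOK-toggleBelow : ∀ v r π → All (_≡ v) (values r) →
  rowsOK (r ∷ toggleMaybe (τ-positionBelow v (planeValues π)) π) ≡ rowsOK (r ∷ π)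
rowsOK-toggleBelow v r [] _ = refl
rowsOK-toggleBelow v r ([] ∷ π) _ = refl
rowsOK-toggleBelow v r (((w , o) ∷ []) ∷ π) r≡v with w ≟ v
... | yes refl rewrite toggleMaybe-below (τ-positionBelow w (planeValues π)) ((w , o) ∷ []) π =
  cong (λ z → nonempty r ∧ rowOK r ∧ colOK r ((w , o) ∷ []) ∧ z)
       (rowsOK-toggleBelow w ((w , o) ∷ []) π (refl ∷ []))
... | no w≢v rewrite colOK-toggleAt-lower 0 r ((w , o) ∷ []) (λ e → w≢v (valueAt-All (values r) 0 r≡v e))
                   | rowsOK-toggleAt-head 0 ((w , o) ∷ []) π (λ ()) = refl
rowsOK-toggleBelow v r (((w , o) ∷ (x , p) ∷ s) ∷ π) r≡v with lastOf x (values s) ≟ v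
... | yes _ = refl
... | no x≢v rewrite colOK-toggleAt-lower (suc (length (values s))) r ((w , o) ∷ (x , p) ∷ s)
                       (λ e → x≢v (valueAt-All (values r) _ r≡v (trans e (valueAt-lastOf x (values s)))))
                   | rowsOK-toggleAt-head (suc (length (values s))) ((w , o) ∷ (x , p) ∷ s) π
                       (λ e → lastOf-inRange x (values s) (trans e (valueAt-length (values s)))) = refl

rowsOK-τ : ∀ π → rowsOK (τ π) ≡ rowsOK π
rowsOK-τ [] = refl
rowsOK-τ ([] ∷ π) = refl
rowsOK-τ (((a , o) ∷ r) ∷ π) with firstChange a (values r) in eq
... | just j = rowsOK-toggleAt-head j ((a , o) ∷ r) π (firstChange-changes a (values r) eq)
... | nothing rewrite toggleMaybe-below (τ-positionBelow a (planeValues π)) ((a , o) ∷ r) π =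
  rowsOK-toggleBelow a ((a , o) ∷ r) π (firstChange-constant a (values r) eq)

-- Hooks

repeated-not-overlined : ∀ a o → T (not o ∨ not (a ≡ᵇ a)) → o ≡ false
repeated-not-overlined a false _ = refl
repeated-not-overlined a true h rewrite ≡ᵇ-refl a = ⊥-elim h

repeated-overlined : ∀ a p → T (not (a ≡ᵇ a) ∨ p) → p ≡ true
repeated-overlined a true _ = refl
repeated-overlined a false h rewrite ≡ᵇ-refl a = ⊥-elim h

rowOK-lastOf≤ : ∀ x q r → T (rowOK ((x , q) ∷ r)) → lastOf x (values r) ≤ x
rowOK-lastOf≤ x q [] _ = ≤-refl
rowOK-lastOf≤ x q ((y , p) ∷ r) h =
  let _ , y≤x , _ , h′ = rowOK-∷∷ x q y p r h in ≤-trans (rowOK-lastOf≤ y p r h′) (≤ᵇ⇒≤ y x y≤x)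

constantRow : ∀ a o r → T (rowOK ((a , o) ∷ r)) → firstChange a (values r) ≡ nothing →
  overlinedAt (length (values r)) ((a , o) ∷ r) ≡ false →
  (a , o) ∷ r ≡ replicate (suc (length (values r))) (a , false)
constantRow a o [] _ _ o≡false = cong (λ o → (a , o) ∷ []) o≡false
constantRow a o ((b , p) ∷ r) ok eq last with a ≟ b
... | yes refl with firstChange a (values r) in eq′
... | nothing =
  let _ , _ , o-ok , ok′ = rowOK-∷∷ a o a p r ok
  in cong₂ _∷_ (cong (a ,_) (repeated-not-overlined a o o-ok)) (constantRow a p r ok′ eq′ last)

overlinedColumnBelow : ∀ a r π → All (_≡ a) (values r) → T (rowsOK (r ∷ π)) →
  τ-positionBelow a (planeValues π) ≡ nothing → π ≡ replicate (length π) ((a , true) ∷ [])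
overlinedColumnBelow a r [] _ _ _ = refl
overlinedColumnBelow a r ([] ∷ π) _ ok _ =
  ⊥-elim (proj₁ (rowsOK-head [] π (proj₂ (proj₂ (proj₂ (rowsOK-∷∷ r [] π ok))))))
overlinedColumnBelow a r (((w , p) ∷ []) ∷ π) r≡a ok eq with w ≟ a
overlinedColumnBelow a r (((w , p) ∷ []) ∷ π) r≡a ok () | no _
overlinedColumnBelow a ((.a , o) ∷ r) (((.a , p) ∷ []) ∷ π) (refl ∷ _) ok eq | yes refl
  with τ-positionBelow a (planeValues π) in eq′
... | nothing =
  let _ , _ , a-above , ok′ = rowsOK-∷∷ ((a , o) ∷ r) ((a , p) ∷ []) π ok
      _ , p-ok , _ = colOK-∷∷ a o r a p [] a-above
  in cong₂ _∷_ (cong (λ p → (a , p) ∷ []) (repeated-overlined a p p-ok))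
               (overlinedColumnBelow a ((a , p) ∷ []) π (refl ∷ []) ok′ eq′)
overlinedColumnBelow a r (((w , p) ∷ (x , q) ∷ s) ∷ π) r≡a ok eq with lastOf x (values s) ≟ a
overlinedColumnBelow a r (((w , p) ∷ (x , q) ∷ s) ∷ π) r≡a ok () | no _
overlinedColumnBelow a ((.a , o) ∷ []) (((w , p) ∷ (x , q) ∷ s) ∷ π) (refl ∷ _) ok eq | yes _ =
  let _ , _ , a-above , _ = rowsOK-∷∷ ((a , o) ∷ []) ((w , p) ∷ (x , q) ∷ s) π ok
  in ⊥-elim (proj₂ (proj₂ (colOK-∷∷ a o [] w p ((x , q) ∷ s) a-above)))
-- Here w = x = a, so the overline of w is required by its column and forbidden by its row.
overlinedColumnBelow a ((.a , o) ∷ (.a , o′) ∷ r) (((w , p) ∷ (x , q) ∷ s) ∷ π) (refl ∷ refl ∷ _) ok eq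
  | yes last≡a =
  let _ , _ , a-above , ok′ = rowsOK-∷∷ ((a , o) ∷ (a , o′) ∷ r) ((w , p) ∷ (x , q) ∷ s) π ok
      w≤a , p-ok , a-above′ = colOK-∷∷ a o ((a , o′) ∷ r) w p ((x , q) ∷ s) a-above
      x≤a , _ = colOK-∷∷ a o′ r x q s a-above′
      _ , x≤w , p-row , ok-row = rowOK-∷∷ w p x q s (proj₂ (rowsOK-head _ π ok′))
      a≤x = subst (_≤ x) last≡a (rowOK-lastOf≤ x q s ok-row)
      x≡a = ≤-antisym (≤ᵇ⇒≤ x a x≤a) a≤x
      w≡a = ≤-antisym (≤ᵇ⇒≤ w a w≤a) (≤-trans a≤x (≤ᵇ⇒≤ x w x≤w))
  in ⊥-elim (overlined-and-not w≡a x≡a p-ok p-row)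
  where
  overlined-and-not : ∀ {w x p} → w ≡ a → x ≡ a → T (not (a ≡ᵇ w) ∨ p) → T (not p ∨ not (w ≡ᵇ x)) → ⊥
  overlined-and-not {p = p} refl refl p-col p-row with repeated-overlined a p p-col
  ... | refl rewrite ≡ᵇ-refl a = p-row

hook : ℕ → ℕ → ℕ → Plane
hook v L h = replicate L (v , false) ∷ replicate h ((v , true) ∷ [])

hook-characterisation : ∀ a o r π → T (rowsOK (((a , o) ∷ r) ∷ π)) → σ-overlined (((a , o) ∷ r) ∷ π) ≡ false →
  isHook (((a , o) ∷ r) ∷ π) ≡ true → ((a , o) ∷ r) ∷ π ≡ hook a (suc (length (values r))) (length π)
hook-characterisation a o r π ok σ-off hook? with firstChange a (values r) in eq
... | nothing with τ-positionBelow a (planeValues π) in eq′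
... | nothing = cong₂ _∷_ (constantRow a o r (proj₂ (rowsOK-head _ π ok)) eq σ-off)
                          (overlinedColumnBelow a ((a , o) ∷ r) π (firstChange-constant a (values r) eq) ok eq′)

overlinedAt-unoverlined : ∀ v j L → overlinedAt j (replicate L (v , false)) ≡ false
overlinedAt-unoverlined v j zero = refl
overlinedAt-unoverlined v zero (suc L) = refl
overlinedAt-unoverlined v (suc j) (suc L) = overlinedAt-unoverlined v j L

firstChange-constantRow : ∀ v L → firstChange v (values (replicate L (v , false))) ≡ nothing
firstChange-constantRow v zero = refl
firstChange-constantRow v (suc L) with v ≟ v
... | yes _ = cong (Maybe.map suc) (firstChange-constantRow v L)
... | no v≢v = ⊥-elim (v≢v refl)

τ-positionBelow-overlinedColumn : ∀ v h →
  τ-positionBelow v (planeValues (replicate h ((v , true) ∷ []))) ≡ nothing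
τ-positionBelow-overlinedColumn v zero = refl
τ-positionBelow-overlinedColumn v (suc h) with v ≟ v
... | yes _ = cong (Maybe.map (map₁ suc)) (τ-positionBelow-overlinedColumn v h)
... | no v≢v = ⊥-elim (v≢v refl)

isHook-hook : ∀ v L h → isHook (hook v (suc L) h) ≡ true
isHook-hook v L h rewrite firstChange-constantRow v L | τ-positionBelow-overlinedColumn v h = refl

σ-overlined-hook : ∀ v L h → σ-overlined (hook v (suc L) h) ≡ false
σ-overlined-hook v L h = overlinedAt-unoverlined v (length (values (replicate L (v , false)))) (suc L)

rowOK-unoverlined : ∀ v L → T (1 ≤ᵇ v) → T (rowOK (replicate (suc L) (v , false)))
rowOK-unoverlined v zero v≥1 = v≥1
rowOK-unoverlined v (suc L) v≥1 rewrite ≤ᵇ-refl v = T-∧-intro v≥1 (rowOK-unoverlined v L v≥1)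

colOK-overlinedBelow : ∀ v o r → T (colOK ((v , o) ∷ r) ((v , true) ∷ []))
colOK-overlinedBelow v o r rewrite ≤ᵇ-refl v | ≡ᵇ-refl v = _

rowsOK-overlinedColumn : ∀ v o r h → T (1 ≤ᵇ v) → T (rowOK ((v , o) ∷ r)) →
  T (rowsOK (((v , o) ∷ r) ∷ replicate h ((v , true) ∷ [])))
rowsOK-overlinedColumn v o r zero _ ok = ok
rowsOK-overlinedColumn v o r (suc h) v≥1 ok =
  T-∧-intro ok (T-∧-intro (colOK-overlinedBelow v o r) (rowsOK-overlinedColumn v true [] h v≥1 v≥1))

rowsOK-hook : ∀ v L h → T (1 ≤ᵇ v) → T (rowsOK (hook v (suc L) h))
rowsOK-hook v L h v≥1 = rowsOK-overlinedColumn v false (replicate L (v , false)) h v≥1 (rowOK-unoverlined v L v≥1)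

sum-values-replicate : ∀ v o L → sum (values (replicate L (v , o))) ≡ L * v
sum-values-replicate v o zero = refl
sum-values-replicate v o (suc L) = cong (v +_) (sum-values-replicate v o L)

weight-hook : ∀ v L h → weight (hook v L h) ≡ L * v + h * v
weight-hook v L h = cong₂ _+_ (sum-values-replicate v false L) (weight-overlinedColumn h)
  where
  weight-overlinedColumn : ∀ h → weight (replicate h ((v , true) ∷ [])) ≡ h * v
  weight-overlinedColumn zero = refl
  weight-overlinedColumn (suc h) = cong₂ _+_ (+-identityʳ v) (weight-overlinedColumn h)

length-hook : ∀ v L h → length (hook v L h) ≡ suc h
length-hook v L h = cong suc (length-replicate h)

-- Plane overpartitions modulo 4

isPlaneOverpartition : ℕ → ℕ → Plane → Bool
isPlaneOverpartition K N π = rowsOK π ∧ (length π ≤ᵇ K) ∧ (weight π ≡ᵇ N)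

weight-planeValues : ∀ π → weight π ≡ sum (map sum (planeValues π))
weight-planeValues [] = refl
weight-planeValues (r ∷ π) = cong (sum (values r) +_) (weight-planeValues π)

isPlaneOverpartition-cong : ∀ K N {π π′} → rowsOK π′ ≡ rowsOK π → planeValues π′ ≡ planeValues π →
  isPlaneOverpartition K N π′ ≡ isPlaneOverpartition K N π
isPlaneOverpartition-cong K N {π} {π′} rows≡ values≡
  rewrite rows≡ | sym (length-map values π) | sym (length-map values π′)
        | weight-planeValues π | weight-planeValues π′ | values≡ = refl

hookTriple : ℕ → ℕ → ℕ × ℕ × ℕ → Bool
hookTriple K N (v , m , h) = (v * m ≡ᵇ N) ∧ (h <ᵇ m) ∧ (h <ᵇ K)

hookTriple-parts : ∀ K N v m h → T (hookTriple K N (v , m , h)) → v * m ≡ N × h < m × h < K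
hookTriple-parts K N v m h t =
  let t₁ , t₂₃ = T-∧-split t ; t₂ , t₃ = T-∧-split t₂₃ in ≡ᵇ⇒≡ _ N t₁ , <ᵇ⇒< h m t₂ , <ᵇ⇒< h K t₃

leg : ℕ × ℕ × ℕ → ℕ
leg (_ , _ , h) = h

leglessTriple : ℕ → ℕ → ℕ × ℕ × ℕ → Bool
leglessTriple K N t = hookTriple K N t ∧ (leg t ≡ᵇ 0)

factor-positive : ∀ v m {N} → 1 ≤ N → v * m ≡ N → T (1 ≤ᵇ v)
factor-positive zero m N≥1 vm≡N = ⊥-elim (<⇒≢ N≥1 vm≡N)
factor-positive (suc _) m _ _ = _

hookParameters : Plane → ℕ × ℕ × ℕ
hookParameters (((a , o) ∷ r) ∷ π) = a , suc (length (values r)) + length π , length π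
hookParameters _ = 0 , 0 , 0

hookOf : ℕ × ℕ × ℕ → Plane
hookOf (v , m , h) = hook v (suc (m ∸ suc h)) h

arm+leg : ∀ {m h} → h < m → suc (m ∸ suc h) + h ≡ m
arm+leg {m} {h} h<m = trans (cong suc (+-comm (m ∸ suc h) h)) (m<ᵇn⇒1+m+[n-1+m]≡n h m (<⇒<ᵇ h<m))

hookParameters-hookOf : ∀ v m h → h < m → hookParameters (hookOf (v , m , h)) ≡ (v , m , h)
hookParameters-hookOf v m h h<m =
  trans (cong₂ (λ L h′ → v , suc L + h′ , h′)
               (trans (length-map proj₁ (replicate (m ∸ suc h) (v , false))) (length-replicate (m ∸ suc h)))
               (length-replicate h))
        (cong (λ m′ → v , m′ , h) (arm+leg h<m))

hookOf-hookParameters : ∀ a o r π →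
  hookOf (hookParameters (((a , o) ∷ r) ∷ π)) ≡ hook a (suc (length (values r))) (length π)
hookOf-hookParameters a o r π =
  cong (λ L → hook a (suc L) (length π))
       (trans (cong (_∸ suc (length π)) (sym (+-suc L (length π)))) (m+n∸n≡m L (suc (length π))))
  where L = length (values r)

module PlaneOverpartitionCount (K N : ℕ) (N≥1 : 1 ≤ N) where

  P₀ : Plane → Bool
  P₀ = isPlaneOverpartition K N

  P₁ : Plane → Bool
  P₁ π = P₀ π ∧ not (σ-overlined π)

  P₀-parts : ∀ π → T (P₀ π) → T (rowsOK π) × T (length π ≤ᵇ K) × T (weight π ≡ᵇ N)
  P₀-parts π p = let p₁ , p₂₃ = T-∧-split p in p₁ , T-∧-split p₂₃

  plane-shape : ∀ π → T (P₀ π) →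
    Σ ℕ λ a → Σ Bool λ o → Σ Row λ r → Σ Plane λ π′ → π ≡ ((a , o) ∷ r) ∷ π′
  plane-shape [] p = ⊥-elim (<⇒≢ N≥1 (≡ᵇ⇒≡ 0 N (proj₂ (proj₂ (P₀-parts [] p)))))
  plane-shape ([] ∷ π) p = ⊥-elim (proj₁ (rowsOK-head [] π (proj₁ (P₀-parts ([] ∷ π) p))))
  plane-shape (((a , o) ∷ r) ∷ π) _ = a , o , r , π , refl

  P₀-σ : ∀ π → P₀ (σ π) ≡ P₀ π
  P₀-σ π = isPlaneOverpartition-cong K N (rowsOK-σ π) (planeValues-toggleBy σ-position π)

  σ-involution : SideSwappingInvolution P₀ (not ∘ σ-overlined)
  σ-involution = record
    { ι = σ
    ; ι-preserves = λ π p → subst T (sym (P₀-σ π)) p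
    ; ι-involutive = λ π _ → toggleBy-involutive σ-position π
    ; ι-swaps = swaps
    }
    where
    swaps : ∀ π → T (P₀ π) → not (σ-overlined (σ π)) ≡ not (not (σ-overlined π))
    swaps π p with plane-shape π p
    ... | a , o , r , π′ , refl =
      cong not (overlinedBy-toggleBy σ-position π refl (σ-position-inRange (planeValues π) refl))

  nonHook-τ : ∀ π → (P₁ (τ π) ∧ not (isHook (τ π))) ≡ (P₁ π ∧ not (isHook π))
  nonHook-τ π
    rewrite isPlaneOverpartition-cong K N (rowsOK-τ π) (planeValues-toggleBy τ-position π)
          | overlinedBy-toggleBy-distinct σ-position τ-position π (σ-τ-distinct (planeValues π))
          | planeValues-toggleBy τ-position π = refl

  τ-involution : SideSwappingInvolution (λ π → P₁ π ∧ not (isHook π)) (not ∘ τ-overlined)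
  τ-involution = record
    { ι = τ
    ; ι-preserves = λ π p → subst T (sym (nonHook-τ π)) p
    ; ι-involutive = λ π _ → toggleBy-involutive τ-position π
    ; ι-swaps = swaps
    }
    where
    swaps : ∀ π → T (P₁ π ∧ not (isHook π)) → not (τ-overlined (τ π)) ≡ not (not (τ-overlined π))
    swaps π p =
      let q , eq = ¬is-nothing⇒just (T-∧-r p)
      in cong not (overlinedBy-toggleBy τ-position π eq (τ-position-inRange (planeValues π) eq))

  hook-shape : ∀ a o r π → T (P₁ (((a , o) ∷ r) ∷ π) ∧ isHook (((a , o) ∷ r) ∷ π)) →
    ((a , o) ∷ r) ∷ π ≡ hook a (suc (length (values r))) (length π)
  hook-shape a o r π p =
    let p₁ , hook? = T-∧-split p ; p₀ , σ-off = T-∧-split p₁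
    in hook-characterisation a o r π (proj₁ (P₀-parts (((a , o) ∷ r) ∷ π) p₀))
         (Equivalence.to T-not-≡ σ-off) (Equivalence.to T-≡ hook?)

  hookTriple-hook : ∀ v L h → T (P₀ (hook v (suc L) h)) → T (hookTriple K N (v , suc L + h , h))
  hookTriple-hook v L h p =
    let _ , length≤K , weight≡N = P₀-parts (hook v (suc L) h) p
        vm≡N = begin
          v * (suc L + h)     ≡⟨ *-comm v (suc L + h) ⟩
          (suc L + h) * v     ≡⟨ *-distribʳ-+ v (suc L) h ⟩
          suc L * v + h * v   ≡⟨ sym (weight-hook v (suc L) h) ⟩
          weight (hook v (suc L) h) ≡⟨ ≡ᵇ⇒≡ _ N weight≡N ⟩
          N ∎
        h<K = subst (_≤ K) (length-hook v (suc L) h) (≤ᵇ⇒≤ _ K length≤K)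
    in T-∧-intro (≡⇒≡ᵇ _ N vm≡N) (T-∧-intro (<⇒<ᵇ (m<n+m h (s≤s z≤n))) (<⇒<ᵇ h<K))
    where open ≡-Reasoning

  hookTriple-hookParameters : ∀ π → T (P₁ π ∧ isHook π) → T (hookTriple K N (hookParameters π))
  hookTriple-hookParameters π p with plane-shape π (T-∧-l (T-∧-l p))
  ... | a , o , r , π′ , refl =
    hookTriple-hook a (length (values r)) (length π′)
      (subst (T ∘ P₀) (hook-shape a o r π′ p) (T-∧-l (T-∧-l p)))

  hook-hookOf : ∀ π → T (P₁ π ∧ isHook π) → hookOf (hookParameters π) ≡ π
  hook-hookOf π p with plane-shape π (T-∧-l (T-∧-l p))
  ... | a , o , r , π′ , refl = trans (hookOf-hookParameters a o r π′) (sym (hook-shape a o r π′ p))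

  hookOf-hook : ∀ t → T (hookTriple K N t) → T (P₁ (hookOf t) ∧ isHook (hookOf t))
  hookOf-hook (v , m , h) t =
    let vm≡N , h<m , h<K = hookTriple-parts K N v m h t
        L = m ∸ suc h
        weight≡N = begin
          weight (hook v (suc L) h) ≡⟨ weight-hook v (suc L) h ⟩
          suc L * v + h * v         ≡⟨ sym (*-distribʳ-+ v (suc L) h) ⟩
          (suc L + h) * v           ≡⟨ cong (_* v) (arm+leg h<m) ⟩
          m * v                     ≡⟨ *-comm m v ⟩
          v * m                     ≡⟨ vm≡N ⟩
          N ∎
        p₀ = T-∧-intro (rowsOK-hook v L h (factor-positive v m N≥1 vm≡N))
               (T-∧-intro (subst (λ n → T (n ≤ᵇ K)) (sym (length-hook v (suc L) h)) (≤⇒≤ᵇ h<K))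
                          (≡⇒≡ᵇ _ N weight≡N))
    in T-∧-intro (T-∧-intro p₀ (subst (T ∘ not) (sym (σ-overlined-hook v L h)) _))
                 (subst T (sym (isHook-hook v L h)) _)
    where
    open ≡-Reasoning

  hooks↔triples : Subset (λ π → P₁ π ∧ isHook π) ↔ Subset (hookTriple K N)
  hooks↔triples = mk↔ₛ′
    (λ (π , p) → hookParameters π , hookTriple-hookParameters π p)
    (λ (t , q) → hookOf t , hookOf-hook t q)
    (λ ((v , m , h) , q) →
      subset-≡ (hookParameters-hookOf v m h (proj₁ (proj₂ (hookTriple-parts K N v m h q)))))
    (λ (π , p) → subset-≡ (hook-hookOf π p))

  count-planeOverpartitions : ∀ {a} → HasCount (PlaneOverpartition K N) a →
    Σ ℕ λ c → Σ ℕ λ x → HasCount (Subset (hookTriple K N)) c × a ≡ 2 * c + 4 * x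
  count-planeOverpartitions e =
    let c₁ , e₁ , a≡2c₁ = count-involution σ-involution e
        c , d , eHook , eNonHook , c₁≡c+d = count-split P₁ isHook e₁
        x , _ , d≡2x = count-involution τ-involution eNonHook
    in c , x , ↔-trans eHook hooks↔triples ,
       twice-sum {b = c₁} {c} {x} a≡2c₁ (trans c₁≡c+d (cong (c +_) d≡2x))

-- Overpartitions modulo 4

ovOK-toggleAt-zero : ∀ r → ovOK (toggleAt 0 r) ≡ ovOK r
ovOK-toggleAt-zero [] = refl
ovOK-toggleAt-zero ((a , o) ∷ []) = refl
ovOK-toggleAt-zero ((a , o) ∷ (b , p) ∷ r) = refl

ovOK-toggleAt-suc : ∀ j r → valueAt (values r) j ≢ valueAt (values r) (suc j) →
  ovOK (toggleAt (suc j) r) ≡ ovOK r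
ovOK-toggleAt-suc j [] _ = refl
ovOK-toggleAt-suc j ((a , o) ∷ []) _ = refl
ovOK-toggleAt-suc zero ((a , o) ∷ (b , p) ∷ r) a≢b rewrite ≡ᵇ-false (just-≢⇒≢ a≢b) =
  cong (λ z → (1 ≤ᵇ a) ∧ (b ≤ᵇ a) ∧ true ∧ z) (ovOK-toggleAt-zero ((b , p) ∷ r))
ovOK-toggleAt-suc (suc j) ((a , o) ∷ (b , p) ∷ r) h =
  cong (λ z → (1 ≤ᵇ a) ∧ (b ≤ᵇ a) ∧ (not (a ≡ᵇ b) ∨ not p) ∧ z) (ovOK-toggleAt-suc j ((b , p) ∷ r) h)

ovOK-∷∷ : ∀ a o b p r → T (ovOK ((a , o) ∷ (b , p) ∷ r)) →
  T (1 ≤ᵇ a) × T (b ≤ᵇ a) × T (not (a ≡ᵇ b) ∨ not p) × T (ovOK ((b , p) ∷ r))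
ovOK-∷∷ a o b p r h =
  let h₁ , h₂₃₄ = T-∧-split h ; h₂ , h₃₄ = T-∧-split h₂₃₄ in h₁ , h₂ , T-∧-split h₃₄

-- τₒ toggles the first entry of the second value, which is a first occurrence and hence free.
τₒ-position : List ℕ → Maybe ℕ
τₒ-position [] = nothing
τₒ-position (a ∷ l) = Maybe.map suc (firstChange a l)

toggleAtMaybe : Maybe ℕ → Row → Row
toggleAtMaybe nothing r = r
toggleAtMaybe (just j) r = toggleAt j r

τₒ : Row → Row
τₒ r = toggleAtMaybe (τₒ-position (values r)) r

τₒ-overlined isConstant : Row → Bool
τₒ-overlined r = Maybe.maybe (λ j → overlinedAt j r) false (τₒ-position (values r))
isConstant r = is-nothing (τₒ-position (values r))

values-τₒ : ∀ r → values (τₒ r) ≡ values r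
values-τₒ r with τₒ-position (values r)
... | nothing = refl
... | just j = values-toggleAt j r

τₒ-involutive : ∀ r → τₒ (τₒ r) ≡ r
τₒ-involutive r rewrite values-τₒ r with τₒ-position (values r)
... | nothing = refl
... | just j = toggleAt-involutive j r

ovOK-τₒ : ∀ r → ovOK (τₒ r) ≡ ovOK r
ovOK-τₒ [] = refl
ovOK-τₒ ((a , o) ∷ r) with firstChange a (values r) in eq
... | nothing = refl
... | just j = ovOK-toggleAt-suc j ((a , o) ∷ r) (firstChange-changes a (values r) eq)

overlinedAt-zero-τₒ : ∀ r → overlinedAt 0 (τₒ r) ≡ overlinedAt 0 r
overlinedAt-zero-τₒ [] = refl
overlinedAt-zero-τₒ ((a , o) ∷ r) with firstChange a (values r)
... | nothing = refl
... | just j = overlinedAt-toggleAt-≢ 0 (suc j) ((a , o) ∷ r) (λ ())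

τₒ-overlined-τₒ : ∀ r → T (not (isConstant r)) → τₒ-overlined (τₒ r) ≡ not (τₒ-overlined r)
τₒ-overlined-τₒ [] ()
τₒ-overlined-τₒ ((a , o) ∷ r) nonconstant
  rewrite values-τₒ ((a , o) ∷ r) with firstChange a (values r) in eq
... | just j = overlinedAt-toggleAt (suc j) ((a , o) ∷ r) (firstChange-inRange a (values r) eq)

constantOverpartition : ∀ a o r → T (ovOK ((a , o) ∷ r)) → firstChange a (values r) ≡ nothing → o ≡ false →
  (a , o) ∷ r ≡ replicate (suc (length r)) (a , false)
constantOverpartition a o [] _ _ o≡false = cong (λ o → (a , o) ∷ []) o≡false
constantOverpartition a o ((b , p) ∷ r) ok eq o≡false with a ≟ b
... | yes refl with firstChange a (values r) in eq′
... | nothing =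
  let _ , _ , p-ok , ok′ = ovOK-∷∷ a o a p r ok
      p≡false = repeated-not-overlined a p (subst T (∨-comm (not (a ≡ᵇ a)) (not p)) p-ok)
  in cong₂ _∷_ (cong (a ,_) o≡false) (constantOverpartition a p r ok′ eq′ p≡false)

ovOK-unoverlined : ∀ v L → T (1 ≤ᵇ v) → T (ovOK (replicate (suc L) (v , false)))
ovOK-unoverlined v zero v≥1 = v≥1
ovOK-unoverlined v (suc L) v≥1 rewrite ≤ᵇ-refl v | ≡ᵇ-refl v = T-∧-intro v≥1 (ovOK-unoverlined v L v≥1)

is-nothing-map-suc : ∀ {x : Maybe ℕ} → T (is-nothing (Maybe.map suc x)) → x ≡ nothing
is-nothing-map-suc {nothing} _ = refl

module OverpartitionCount (K N : ℕ) (N≥1 : 1 ≤ N) (K≥1 : 1 ≤ K) where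

  Q₀ : Row → Bool
  Q₀ r = ovOK r ∧ (sum (values r) ≡ᵇ N)

  Q₁ : Row → Bool
  Q₁ r = Q₀ r ∧ not (overlinedAt 0 r)

  Q₀-cong : ∀ {r r′} → ovOK r′ ≡ ovOK r → values r′ ≡ values r → Q₀ r′ ≡ Q₀ r
  Q₀-cong ovOK≡ values≡ rewrite ovOK≡ | values≡ = refl

  σₒ-involution : SideSwappingInvolution Q₀ (not ∘ overlinedAt 0)
  σₒ-involution = record
    { ι = toggleAt 0
    ; ι-preserves = λ r q → subst T (sym (Q₀-cong (ovOK-toggleAt-zero r) (values-toggleAt 0 r))) q
    ; ι-involutive = λ r _ → toggleAt-involutive 0 r
    ; ι-swaps = swaps
    }
    where
    swaps : ∀ r → T (Q₀ r) → not (overlinedAt 0 (toggleAt 0 r)) ≡ not (not (overlinedAt 0 r))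
    swaps [] q = ⊥-elim (<⇒≢ N≥1 (≡ᵇ⇒≡ 0 N q))
    swaps ((a , o) ∷ r) _ = refl

  nonConstant-τₒ : ∀ r → (Q₁ (τₒ r) ∧ not (isConstant (τₒ r))) ≡ (Q₁ r ∧ not (isConstant r))
  nonConstant-τₒ r rewrite Q₀-cong (ovOK-τₒ r) (values-τₒ r) | overlinedAt-zero-τₒ r | values-τₒ r = refl

  τₒ-involution : SideSwappingInvolution (λ r → Q₁ r ∧ not (isConstant r)) (not ∘ τₒ-overlined)
  τₒ-involution = record
    { ι = τₒ
    ; ι-preserves = λ r q → subst T (sym (nonConstant-τₒ r)) q
    ; ι-involutive = λ r _ → τₒ-involutive r
    ; ι-swaps = λ r q → cong not (τₒ-overlined-τₒ r (T-∧-r q))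
    }

  constantParameters : Row → ℕ × ℕ × ℕ
  constantParameters [] = 0 , 0 , 0
  constantParameters ((a , _) ∷ r) = a , suc (length r) , 0

  constant-parts : ∀ r → T (Q₁ r ∧ isConstant r) →
    T (ovOK r) × T (sum (values r) ≡ᵇ N) × T (not (overlinedAt 0 r)) × T (isConstant r)
  constant-parts r q =
    let q₁ , constant = T-∧-split q
        q₀ , unoverlined = T-∧-split {Q₀ r} q₁
        ok , sum≡N = T-∧-split {ovOK r} q₀
    in ok , sum≡N , unoverlined , constant

  constant-shape : ∀ a o r → T (Q₁ ((a , o) ∷ r) ∧ isConstant ((a , o) ∷ r)) →
    (a , o) ∷ r ≡ replicate (suc (length r)) (a , false)
  constant-shape a o r q =
    let ok , _ , unoverlined , constant = constant-parts ((a , o) ∷ r) q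
    in constantOverpartition a o r ok (is-nothing-map-suc constant) (Equivalence.to T-not-≡ unoverlined)

  leglessTriple-constantParameters : ∀ r → T (Q₁ r ∧ isConstant r) →
    T (leglessTriple K N (constantParameters r))
  leglessTriple-constantParameters [] q = ⊥-elim (<⇒≢ N≥1 (≡ᵇ⇒≡ 0 N (proj₁ (proj₂ (constant-parts [] q)))))
  leglessTriple-constantParameters ((a , o) ∷ r) q =
    T-∧-intro (T-∧-intro (≡⇒≡ᵇ _ N am≡N) (<⇒<ᵇ K≥1)) _
    where
    open ≡-Reasoning
    am≡N : a * suc (length r) ≡ N
    am≡N = begin
      a * suc (length r)                              ≡⟨ *-comm a (suc (length r)) ⟩
      suc (length r) * a                              ≡⟨ sym (sum-values-replicate a false (suc (length r))) ⟩
      sum (values (replicate (suc (length r)) (a , false))) ≡⟨ cong (sum ∘ values) (sym (constant-shape a o r q)) ⟩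
      sum (values ((a , o) ∷ r))                      ≡⟨ ≡ᵇ⇒≡ _ N (proj₁ (proj₂ (constant-parts ((a , o) ∷ r) q))) ⟩
      N ∎

  constant-valid : ∀ v m h → T (leglessTriple K N (v , m , h)) →
    T (Q₁ (replicate m (v , false)) ∧ isConstant (replicate m (v , false)))
  constant-valid v zero h t = ⊥-elim (n≮0 (proj₁ (proj₂ (hookTriple-parts K N v 0 h (T-∧-l t)))))
  constant-valid v (suc m) h t rewrite firstChange-constantRow v m =
    let vm≡N , _ = hookTriple-parts K N v (suc m) h (T-∧-l t)
        sum≡N = trans (sum-values-replicate v false (suc m)) (trans (*-comm (suc m) v) vm≡N)
        ok = ovOK-unoverlined v m (factor-positive v (suc m) N≥1 vm≡N)
    in T-∧-intro (T-∧-intro (T-∧-intro ok (≡⇒≡ᵇ _ N sum≡N)) _) _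

  constants↔leglessTriples : Subset (λ r → Q₁ r ∧ isConstant r) ↔ Subset (leglessTriple K N)
  constants↔leglessTriples = mk↔ₛ′
    (λ (r , q) → constantParameters r , leglessTriple-constantParameters r q)
    (λ ((v , m , h) , t) → replicate m (v , false) , constant-valid v m h t)
    (λ ((v , m , h) , t) → subset-≡ (parameters-replicate v m h t))
    (λ (r , q) → subset-≡ (replicate-parameters r q))
    where
    parameters-replicate : ∀ v m h → T (leglessTriple K N (v , m , h)) →
      constantParameters (replicate m (v , false)) ≡ (v , m , h)
    parameters-replicate v zero h t = ⊥-elim (n≮0 (proj₁ (proj₂ (hookTriple-parts K N v 0 h (T-∧-l t)))))
    parameters-replicate v (suc m) h t =
      cong₂ (λ m′ h′ → v , suc m′ , h′) (length-replicate m) (sym (≡ᵇ⇒≡ h 0 (T-∧-r t)))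
    replicate-parameters : ∀ r → T (Q₁ r ∧ isConstant r) →
      replicate (proj₁ (proj₂ (constantParameters r))) (proj₁ (constantParameters r) , false) ≡ r
    replicate-parameters [] q = refl
    replicate-parameters ((a , o) ∷ r) q = sym (constant-shape a o r q)

  count-overpartitions : ∀ {b} → HasCount (Overpartition N) b →
    Σ ℕ λ d → Σ ℕ λ y → HasCount (Subset (leglessTriple K N)) d × b ≡ 2 * d + 4 * y
  count-overpartitions e =
    let d₁ , e₁ , b≡2d₁ = count-involution σₒ-involution e
        d , d′ , eConst , eNonConst , d₁≡d+d′ = count-split Q₁ isConstant e₁
        y , _ , d′≡2y = count-involution τₒ-involution eNonConst
    in d , y , ↔-trans eConst constants↔leglessTriples ,
       twice-sum {b = d₁} {d} {y} b≡2d₁ (trans d₁≡d+d′ (cong (d +_) d′≡2y))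

-- Hook triples

double<sum-swap : ∀ x h → x ≢ h → (x + x <ᵇ x + h) ≡ not (h + h <ᵇ x + h)
double<sum-swap x h x≢h with <-cmp x h
... | tri< x<h _ _ rewrite <ᵇ-true (x + x) (x + h) (+-monoʳ-< x x<h)
                         | <ᵇ-false (h + h) (x + h) (<-asym (+-monoˡ-< h x<h)) = refl
... | tri≈ _ x≡h _ = ⊥-elim (x≢h x≡h)
... | tri> _ _ h<x rewrite <ᵇ-false (x + x) (x + h) (<-asym (+-monoʳ-< x h<x))
                         | <ᵇ-true (h + h) (x + h) (+-monoˡ-< h h<x) = refl

-- The positive legs of a hook triple (v, m, h) are 0 < h < m ⊓ K, a range symmetric under h ↦ m ⊓ K − h.
module LegReflection (K N : ℕ) where

  legged : ℕ × ℕ × ℕ → Bool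
  legged t = hookTriple K N t ∧ not (leg t ≡ᵇ 0)

  balanced shortLeg : ℕ × ℕ × ℕ → Bool
  balanced (v , m , h) = h + h ≡ᵇ m ⊓ K
  shortLeg (v , m , h) = h + h <ᵇ m ⊓ K

  reflectLeg : ℕ × ℕ × ℕ → ℕ × ℕ × ℕ
  reflectLeg (v , m , h) = v , m , m ⊓ K ∸ h

  unbalanced-parts : ∀ v m h → T (legged (v , m , h) ∧ not (balanced (v , m , h))) →
    v * m ≡ N × 0 < h × h < m ⊓ K × h + h ≢ m ⊓ K
  unbalanced-parts v m h p =
    let p₁ , unbalanced = T-∧-split p ; triple , h≢0 = T-∧-split p₁
        vm≡N , h<m , h<K = hookTriple-parts K N v m h triple
    in vm≡N , n≢0⇒n>0 (T-not-≡ᵇ⇒≢ h≢0) , ⊓-pres-m< h<m h<K , T-not-≡ᵇ⇒≢ unbalanced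

  unbalanced-intro : ∀ v m h → v * m ≡ N → 0 < h → h < m ⊓ K → h + h ≢ m ⊓ K →
    T (legged (v , m , h) ∧ not (balanced (v , m , h)))
  unbalanced-intro v m h vm≡N h>0 h<M hh≢M =
    let h<m = <-≤-trans h<M (m⊓n≤m m K) ; h<K = <-≤-trans h<M (m⊓n≤n m K)
        triple = T-∧-intro (≡⇒≡ᵇ _ N vm≡N) (T-∧-intro (<⇒<ᵇ h<m) (<⇒<ᵇ h<K))
    in T-∧-intro (T-∧-intro triple (≢⇒T-not-≡ᵇ (≢-sym (<⇒≢ h>0)))) (≢⇒T-not-≡ᵇ hh≢M)

  reflection : SideSwappingInvolution (λ t → legged t ∧ not (balanced t)) shortLeg
  reflection = record
    { ι = reflectLeg
    ; ι-preserves = preserves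
    ; ι-involutive = λ (v , m , h) p →
        let _ , _ , h<M , _ = unbalanced-parts v m h p in cong (λ h′ → v , m , h′) (m∸[m∸n]≡n (<⇒≤ h<M))
    ; ι-swaps = swaps
    }
    where
    preserves : ∀ t → T (legged t ∧ not (balanced t)) →
      T (legged (reflectLeg t) ∧ not (balanced (reflectLeg t)))
    preserves (v , m , h) p =
      let vm≡N , h>0 , h<M , hh≢M = unbalanced-parts v m h p
          x = m ⊓ K ∸ h
          x+h≡M = m∸n+n≡m (<⇒≤ h<M)
          h≡x : x + x ≡ m ⊓ K → h ≡ x
          h≡x xx≡M = sym (+-cancelˡ-≡ x _ _ (trans xx≡M (sym x+h≡M)))
      in unbalanced-intro v m x vm≡N (m<n⇒0<n∸m h<M) (subst (x <_) x+h≡M (m<m+n x h>0))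
           (λ xx≡M → hh≢M (trans (cong (_+ h) (h≡x xx≡M)) x+h≡M))
    swaps : ∀ t → T (legged t ∧ not (balanced t)) → shortLeg (reflectLeg t) ≡ not (shortLeg t)
    swaps (v , m , h) p =
      let _ , _ , h<M , hh≢M = unbalanced-parts v m h p
          x+h≡M = m∸n+n≡m (<⇒≤ h<M)
          x = m ⊓ K ∸ h
      in subst (λ M → (x + x <ᵇ M) ≡ not (h + h <ᵇ M)) x+h≡M
           (double<sum-swap x h (λ x≡h → hh≢M (trans (cong (_+ h) (sym x≡h)) x+h≡M)))

2*n≡n+n : ∀ n → 2 * n ≡ n + n
2*n≡n+n n = cong (n +_) (+-identityʳ n)

module BalancedHookTriples (k N : ℕ) where

  K : ℕ
  K = 2 * k + 1

  open LegReflection K N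

  Balanced : Set
  Balanced = Subset (λ t → legged t ∧ balanced t)

  double≤K⇒≤k : ∀ {h} → 2 * h ≤ K → h ≤ k
  double≤K⇒≤k {h} 2h≤K =
    *-cancelˡ-≤ 2 (<⇒≤pred (≤∧≢⇒< (subst (2 * h ≤_) (+-comm (2 * k) 1) 2h≤K) (even≢odd h k)))

  -- As K is odd, h + h = m ⊓ K forces m ⊓ K = m.
  balanced-parts : ∀ v m h → T (legged (v , m , h) ∧ balanced (v , m , h)) →
    v * (2 * h) ≡ N × m ≡ 2 * h × 1 ≤ h × h ≤ k
  balanced-parts v m h p =
    let p₁ , hh≡M = T-∧-split p ; triple , h≢0 = T-∧-split p₁
        vm≡N , _ = hookTriple-parts K N v m h triple
        2h≡M = trans (2*n≡n+n h) (≡ᵇ⇒≡ (h + h) (m ⊓ K) hh≡M)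
        m≤K = ≮⇒≥ (λ K<m → even≢odd h k (trans 2h≡M (trans (m≥n⇒m⊓n≡n (<⇒≤ K<m)) (+-comm (2 * k) 1))))
        m≡2h = sym (trans 2h≡M (m≤n⇒m⊓n≡m m≤K))
    in subst (λ m → v * m ≡ N) m≡2h vm≡N , m≡2h , n≢0⇒n>0 (T-not-≡ᵇ⇒≢ h≢0) ,
       double≤K⇒≤k (subst (_≤ K) m≡2h m≤K)

  balancedTriple : ∀ h → 1 ≤ h → h ≤ k → 2 * h ∣ N → Balanced
  balancedTriple h h≥1 h≤k (divides q N≡q2h) =
    (q , 2 * h , h) ,
    T-∧-intro (T-∧-intro triple (≢⇒T-not-≡ᵇ (≢-sym (<⇒≢ h≥1))))
              (≡⇒≡ᵇ (h + h) _ (trans (sym (2*n≡n+n h)) (sym (m≤n⇒m⊓n≡m 2h≤K))))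
    where
    h<2h : h < 2 * h
    h<2h = m<m+n h (<-≤-trans h≥1 (m≤m+n h 0))
    k<K : k < K
    k<K = ≤-<-trans (m≤m+n k (k + 0)) (subst (2 * k <_) (+-comm 1 (2 * k)) (n<1+n (2 * k)))
    2h≤K : 2 * h ≤ K
    2h≤K = ≤-trans (*-monoʳ-≤ 2 h≤k) (m≤m+n (2 * k) 1)
    triple : T (hookTriple K N (q , 2 * h , h))
    triple = T-∧-intro (≡⇒≡ᵇ _ N (sym N≡q2h)) (T-∧-intro (<⇒<ᵇ h<2h) (<⇒<ᵇ (≤-<-trans h≤k k<K)))

  balancedTriple-unique : ∀ (t : Balanced) h h≥1 h≤k 2h∣N → leg (proj₁ t) ≡ h →
    balancedTriple h h≥1 h≤k 2h∣N ≡ t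
  balancedTriple-unique ((v , m , h) , p) .h h≥1 h≤k (divides q N≡q2h) refl =
    subset-≡ (cong₂ _,_ (sym v≡q) (cong (_, h) (sym m≡2h)))
    where
    parts = balanced-parts v m h p
    m≡2h = proj₁ (proj₂ parts)
    v≡q : v ≡ q
    v≡q = *-cancelʳ-≡ v q (2 * h) {{>-nonZero (<-≤-trans h≥1 (m≤m+n h (h + 0)))}}
            (trans (proj₁ parts) N≡q2h)

  count-balanced : ∀ {c} (ℓ : Fin c → ℕ) → (∀ {i j} → ℓ i ≡ ℓ j → i ≡ j) →
    (∀ i → 1 ≤ ℓ i × ℓ i ≤ k × 2 * ℓ i ∣ N) →
    (∀ h → 1 ≤ h → h ≤ k → 2 * h ∣ N → Σ (Fin c) λ i → ℓ i ≡ h) →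
    HasCount Balanced c
  count-balanced ℓ ℓ-injective ℓ-balanced ℓ-onto = mk↔ₛ′ to from to∘from from∘to
    where
    to : Fin _ → Balanced
    to i = let h≥1 , h≤k , 2h∣N = ℓ-balanced i in balancedTriple (ℓ i) h≥1 h≤k 2h∣N
    preimage : (t : Balanced) → Σ (Fin _) λ i → ℓ i ≡ leg (proj₁ t)
    preimage ((v , m , h) , p) =
      let vm≡N , _ , h≥1 , h≤k = balanced-parts v m h p in ℓ-onto h h≥1 h≤k (divides v (sym vm≡N))
    from : Balanced → Fin _
    from t = proj₁ (preimage t)
    to∘from : ∀ t → to (from t) ≡ t
    to∘from t =
      let h≥1 , h≤k , 2h∣N = ℓ-balanced (from t) in balancedTriple-unique t _ h≥1 h≤k 2h∣N (sym (proj₂ (preimage t)))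
    from∘to : ∀ i → from (to i) ≡ i
    from∘to i = ℓ-injective (proj₂ (preimage (to i)))

  count-hookTriples : ∀ {c t} → HasCount (Subset (hookTriple K N)) c → HasCount Balanced (2 * t) →
    Σ ℕ λ d → Σ ℕ λ z → HasCount (Subset (leglessTriple K N)) d × c ≡ d + 2 * z
  count-hookTriples {t = t} eTriple eBalanced =
    let d , e , eLegless , eLegged , c≡d+e = count-split (hookTriple K N) (λ t → leg t ≡ᵇ 0) eTriple
        f , g , eBal , eUnbal , e≡f+g = count-split legged balanced eLegged
        l , _ , g≡2l = count-involution reflection eUnbal
        f≡2t = count-unique eBal eBalanced
    in d , t + l , eLegless ,
       trans c≡d+e (cong (d +_) (trans e≡f+g (trans (cong₂ _+_ f≡2t g≡2l) (sym (*-distribˡ-+ 2 t l)))))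

mod4-agree : ∀ {a b c d x y z} → a ≡ 2 * c + 4 * x → c ≡ d + 2 * z → b ≡ 2 * d + 4 * y → a % 4 ≡ b % 4
mod4-agree {d = d} {x} {y} {z} refl refl refl =
  trans (cong (_% 4) (a≡ d z x)) (trans ([m+kn]%n≡m%n (2 * d) (z + x) 4)
        (sym (trans (cong (_% 4) (+-comm-right d y)) ([m+kn]%n≡m%n (2 * d) y 4))))
  where
  a≡ : ∀ d z x → 2 * (d + 2 * z) + 4 * x ≡ 2 * d + (z + x) * 4
  a≡ = solve-∀
  +-comm-right : ∀ d y → 2 * d + 4 * y ≡ 2 * d + y * 4
  +-comm-right = solve-∀

count-planeOverpartitions-zero : ∀ K → HasCount (PlaneOverpartition K 0) 1
count-planeOverpartitions-zero K = count-one ([] , _) unique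
  where
  unique : ∀ π → ([] , _) ≡ π
  unique ([] , _) = refl
  unique (([] ∷ π) , p) = ⊥-elim (proj₁ (rowsOK-head [] π (T-∧-l p)))
  unique ((((zero , o) ∷ r) ∷ π) , p) = ⊥-elim (rowOK-zero o r (proj₂ (rowsOK-head ((zero , o) ∷ r) π (T-∧-l p))))
    where
    rowOK-zero : ∀ o r → ¬ T (rowOK ((zero , o) ∷ r))
    rowOK-zero o [] ()
    rowOK-zero o (_ ∷ _) ()
  unique ((((suc a , o) ∷ r) ∷ π) , p) =
    ⊥-elim (T-∧-r {length (((suc a , o) ∷ r) ∷ π) ≤ᵇ K} (T-∧-r {rowsOK (((suc a , o) ∷ r) ∷ π)} p))

count-overpartitions-zero : HasCount (Overpartition 0) 1
count-overpartitions-zero = count-one ([] , _) unique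
  where
  unique : ∀ r → ([] , _) ≡ r
  unique ([] , _) = refl
  unique (((zero , o) ∷ []) , ())
  unique (((zero , o) ∷ _ ∷ _) , ())
  unique (((suc a , o) ∷ r) , p) = ⊥-elim (T-∧-r {ovOK ((suc a , o) ∷ r)} p)

planeOverpartitions≡overpartitions-mod4 : ∀ k N t → 1 ≤ N →
  HasCount (BalancedHookTriples.Balanced k N) (2 * t) →
  ∀ a b → HasCount (PlaneOverpartition (2 * k + 1) N) a → HasCount (Overpartition N) b → a % 4 ≡ b % 4
planeOverpartitions≡overpartitions-mod4 k N t N≥1 eBalanced a b ea eb =
  let c , x , eHook , a≡ = PlaneOverpartitionCount.count-planeOverpartitions (2 * k + 1) N N≥1 ea
      d , y , eLegless , b≡ = OverpartitionCount.count-overpartitions (2 * k + 1) N N≥1 (m≤n+m 1 (2 * k)) eb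
      d′ , z , eLegless′ , c≡ = BalancedHookTriples.count-hookTriples k N {t = t} eHook eBalanced
  in mod4-agree {c = c} {d} {x} {y} {z} a≡ (trans c≡ (cong (_+ 2 * z) (count-unique eLegless′ eLegless))) b≡

2*h∣lcmEven : ∀ k h → 1 ≤ h → h ≤ k → 2 * h ∣ lcmEven k
2*h∣lcmEven zero zero () _
2*h∣lcmEven zero (suc _) _ ()
2*h∣lcmEven (suc k) h h≥1 h≤1+k with h ≤? k
... | yes h≤k = ∣-trans (2*h∣lcmEven k h h≥1 h≤k) (n∣lcm[m,n] (2 * suc k) (lcmEven k))
... | no h≰k rewrite ≤-antisym h≤1+k (≰⇒> h≰k) = m∣lcm[m,n] (2 * suc k) (lcmEven k)

lcmEven-positive : ∀ k → 1 ≤ lcmEven k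
lcmEven-positive zero = ≤-refl
lcmEven-positive (suc k) = n≢0⇒n>0 λ lcm≡0 →
  [ (λ ()) , <⇒≢ (lcmEven-positive k) ∘ sym ]′ (m*n≡0⇒m≡0∨n≡0 (2 * suc k) (begin
    2 * suc k * lcmEven k      ≡⟨ sym (gcd*lcm (2 * suc k) (lcmEven k)) ⟩
    gcd (2 * suc k) (lcmEven k) * lcm (2 * suc k) (lcmEven k) ≡⟨ cong (gcd (2 * suc k) (lcmEven k) *_) lcm≡0 ⟩
    gcd (2 * suc k) (lcmEven k) * 0 ≡⟨ *-zeroʳ (gcd (2 * suc k) (lcmEven k)) ⟩
    0 ∎))
  where open ≡-Reasoning

2^-injective : ∀ {a b} → 2 ^ a ≡ 2 ^ b → a ≡ b
2^-injective {a} {b} 2^a≡2^b with <-cmp a b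
... | tri< a<b _ _ = ⊥-elim (<⇒≢ (^-monoʳ-< 2 (s≤s (s≤s z≤n)) a<b) 2^a≡2^b)
... | tri≈ _ a≡b _ = a≡b
... | tri> _ _ b<a = ⊥-elim (<⇒≢ (^-monoʳ-< 2 (s≤s (s≤s z≤n)) b<a) (sym 2^a≡2^b))

∤2⇒coprime-2 : ∀ d → ¬ 2 ∣ d → Coprime d 2
∤2⇒coprime-2 d 2∤d {c} (c∣d , c∣2) with ∣⇒≤ c∣2
∤2⇒coprime-2 d 2∤d {zero} (c∣d , c∣2) | _ with 0∣⇒≡0 c∣2
... | ()
∤2⇒coprime-2 d 2∤d {suc zero} _ | _ = refl
∤2⇒coprime-2 d 2∤d {suc (suc zero)} (c∣d , _) | _ = ⊥-elim (2∤d c∣d)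
∤2⇒coprime-2 d 2∤d {suc (suc (suc c))} _ | s≤s (s≤s ())

∣2^⇒≡2^ : ∀ e d → d ∣ 2 ^ e → Σ ℕ λ i → i ≤ e × d ≡ 2 ^ i
∣2^⇒≡2^ zero d d∣1 = 0 , z≤n , ∣1⇒≡1 d∣1
∣2^⇒≡2^ (suc e) d d∣2^1+e with 2 ∣? d
... | yes (divides q d≡q*2) =
  let i , i≤e , q≡2^i = ∣2^⇒≡2^ e q (*-cancelˡ-∣ 2 (subst (_∣ 2 ^ suc e) (trans d≡q*2 (*-comm q 2)) d∣2^1+e))
  in suc i , s≤s i≤e , trans d≡q*2 (trans (*-comm q 2) (cong (2 *_) q≡2^i))
... | no 2∤d =
  let i , i≤e , d≡2^i = ∣2^⇒≡2^ e d (coprime-divisor (∤2⇒coprime-2 d 2∤d) d∣2^1+e)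
  in i , m≤n⇒m≤1+n i≤e , d≡2^i

2^∣2^ : ∀ {i e} → i ≤ e → 2 ^ i ∣ 2 ^ e
2^∣2^ {e = e} z≤n = 1∣ (2 ^ e)
2^∣2^ (s≤s i≤e) = *-monoʳ-∣ 2 (2^∣2^ i≤e)

balanced-all : ∀ k N → (∀ h → 1 ≤ h → h ≤ k → 2 * h ∣ N) → HasCount (BalancedHookTriples.Balanced k N) k
balanced-all k N all-balanced =
  BalancedHookTriples.count-balanced k N (suc ∘ toℕ) (toℕ-injective ∘ suc-injective)
    (λ i → s≤s z≤n , toℕ<n i , all-balanced _ (s≤s z≤n) (toℕ<n i)) onto
  where
  onto : ∀ h → 1 ≤ h → h ≤ k → 2 * h ∣ N → Σ (Fin k) λ i → suc (toℕ i) ≡ h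
  onto (suc h) _ h<k _ = fromℕ< h<k , cong suc (toℕ-fromℕ< h<k)

balanced-powersOfTwo : ∀ k N e → 2 ^ e ≤ k →
  (∀ h → 1 ≤ h → h ≤ k → (2 * h ∣ N → h ∣ 2 ^ e) × (h ∣ 2 ^ e → 2 * h ∣ N)) →
  HasCount (BalancedHookTriples.Balanced k N) (suc e)
balanced-powersOfTwo k N e 2^e≤k balanced⇔∣2^e =
  BalancedHookTriples.count-balanced k N (λ i → 2 ^ toℕ i) (toℕ-injective ∘ 2^-injective) ℓ-balanced onto
  where
  2^i≤k : ∀ (i : Fin (suc e)) → 2 ^ toℕ i ≤ k
  2^i≤k i = ≤-trans (^-monoʳ-≤ 2 (≤-pred (toℕ<n i))) 2^e≤k
  ℓ-balanced : ∀ i → 1 ≤ 2 ^ toℕ i × 2 ^ toℕ i ≤ k × 2 * 2 ^ toℕ i ∣ N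
  ℓ-balanced i = m^n>0 2 (toℕ i) , 2^i≤k i ,
    proj₂ (balanced⇔∣2^e _ (m^n>0 2 (toℕ i)) (2^i≤k i)) (2^∣2^ (≤-pred (toℕ<n i)))
  onto : ∀ h → 1 ≤ h → h ≤ k → 2 * h ∣ N → Σ (Fin (suc e)) λ i → 2 ^ toℕ i ≡ h
  onto h h≥1 h≤k 2h∣N =
    let i , i≤e , h≡2^i = ∣2^⇒≡2^ e h (proj₁ (balanced⇔∣2^e h h≥1 h≤k) 2h∣N)
    in fromℕ< (s≤s i≤e) , trans (cong (2 ^_) (toℕ-fromℕ< (s≤s i≤e))) (sym h≡2^i)

even⇒2*half : ∀ m → m % 2 ≡ 0 → Σ ℕ λ t → m ≡ 2 * t
even⇒2*half m m%2≡0 with m%n≡0⇒n∣m m 2 m%2≡0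
... | divides t m≡t*2 = t , trans m≡t*2 (*-comm t 2)

2*h∣L+2^1+e⇔h∣2^e : ∀ {L h} e → 2 * h ∣ L →
  (2 * h ∣ L + 2 ^ suc e → h ∣ 2 ^ e) × (h ∣ 2 ^ e → 2 * h ∣ L + 2 ^ suc e)
2*h∣L+2^1+e⇔h∣2^e e 2h∣L =
  (λ 2h∣N → *-cancelˡ-∣ 2 (∣m+n∣m⇒∣n 2h∣N 2h∣L)) , (λ h∣2^e → ∣m∣n⇒∣m+n 2h∣L (*-monoʳ-∣ 2 h∣2^e))

mod4-at-lcmEven*n+2^j : ∀ k n j → 1 ≤ j → j % 2 ≡ 0 → 2 ^ (j ∸ 1) ≤ k → ∀ a b →
  HasCount (PlaneOverpartition (2 * k + 1) (lcmEven k * n + 2 ^ j)) a →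
  HasCount (Overpartition (lcmEven k * n + 2 ^ j)) b → a % 4 ≡ b % 4
mod4-at-lcmEven*n+2^j k n (suc e) _ j-even 2^e≤k =
  let t , j≡2t = even⇒2*half (suc e) j-even
      balanced⇔∣2^e h h≥1 h≤k = 2*h∣L+2^1+e⇔h∣2^e e (∣m⇒∣m*n n (2*h∣lcmEven k h h≥1 h≤k))
  in planeOverpartitions≡overpartitions-mod4 k _ t (≤-trans (m^n>0 2 (suc e)) (m≤n+m _ (lcmEven k * n)))
       (subst (HasCount _) j≡2t (balanced-powersOfTwo k _ e 2^e≤k balanced⇔∣2^e))

mod4-at-lcmEven*n : ∀ k → k % 2 ≡ 0 → ∀ n a b → HasCount (PlaneOverpartition (2 * k + 1) (lcmEven k * n)) a →
  HasCount (Overpartition (lcmEven k * n)) b → a % 4 ≡ b % 4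
mod4-at-lcmEven*n k _ zero a b ea eb rewrite *-zeroʳ (lcmEven k) =
  cong (_% 4) (trans (count-unique ea (count-planeOverpartitions-zero _)) (count-unique count-overpartitions-zero eb))
mod4-at-lcmEven*n k k-even (suc n) =
  let t , k≡2t = even⇒2*half k k-even
  in planeOverpartitions≡overpartitions-mod4 k _ t (*-mono-≤ (lcmEven-positive k) (s≤s z≤n))
       (subst (HasCount _) k≡2t (balanced-all k _ (λ h h≥1 h≤k → ∣m⇒∣m*n (suc n) (2*h∣lcmEven k h h≥1 h≤k))))

theorem1p7 : (k : ℕ) → 2 ≤ k →
    ((n j : ℕ) → 1 ≤ n → 2 ≤ j → j % 2 ≡ 0 → 2 ^ (j ∸ 1) ≤ k →
    (a b : ℕ) → HasCount (PlaneOverpartition (2 * k + 1) (lcmEven k * n + 2 ^ j)) a →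
    HasCount (Overpartition (lcmEven k * n + 2 ^ j)) b → a % 4 ≡ b % 4)
    × (k % 2 ≡ 0 → (n : ℕ) →
    (a b : ℕ) → HasCount (PlaneOverpartition (2 * k + 1) (lcmEven k * n)) a →
    HasCount (Overpartition (lcmEven k * n)) b → a % 4 ≡ b % 4)
theorem1p7 k _ = (λ n j _ j≥2 → mod4-at-lcmEven*n+2^j k n j (<⇒≤ j≥2)) , mod4-at-lcmEven*n k
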